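{- Consider a financial network without default cost in which all payment functions are monotone, piecewise-linear and strictly monotone. Then there is no claims trade (of a claim $e=(u,v)\in E$ to a buyer bank $w$, with any admissible return $\rho$) that strictly improves the assets of both the buyer $w$ and the creditor $v$ with respect to the minimal clearing state, i.e., there is no such trade with $\hat{a}^{\rho}_v>\hat{a}_v$ and $\hat{a}^{\rho}_w>\hat{a}_w$.
   Context: A financial network consists of a finite set $V$ of banks and a set $E$ of directed edges (claims) on $V$, with no self-loops and no parallel edges. An edge $e=(u,v)$ has debtor $u$, creditor $v$ and liability $\ell_e\ge0$. Each bank $v$ has external assets $a^{(x)}_v\ge0$. Let $E^+(v)=\{(v,w)\in E\}$, $E^-(v)=\{(u,v)\in E\}$, $L^+(v)=\sum_{e\in E^+(v)}\ell_e$. Each edge $e\in E^+(u)$ has a payment function $p_e:\mathbb{R}\to\mathbb{R}$ (payment on $e$ as a function of $u$'s assets) such that for all $a\ge0$, $\varepsilon>0$: $p_e(a)\in[0,\ell_e]$, $p_e(a)\le p_e(a+\varepsilon)$, $\sum_{e\in E^+(u)}p_e(a)=\min\{a,L^+(u)\}$. It is piecewise-linear if there are $k_e\ge1$, borders $0=x_{e,0}<\dots<x_{e,k_e}=L^+(u)<x_{e,k_e+1}=\infty$ and slopes $m_{e,i}\ge0$ with $p_e(a)=m_{e,i}(a-x_{e,i-1})+p_e(x_{e,i-1})$ on $[x_{e,i-1},x_{e,i})$. A payment function is strictly monotone if $p_e(a)<p_e(a+\varepsilon)$ for every $a\ge0$ and every $\varepsilon\in(0,\ell_e-a]$. In a network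 without default cost, a clearing state is a vector $\mathbf{a}\ge0$ with $a_v=a^{(x)}_v+\sum_{(u,v)\in E^-(v)}p_{(u,v)}(a_u)$ for all $v$; clearing states form a complete lattice under the coordinatewise order, and $\hat{\mathbf{a}}$ denotes its least element (minimal clearing state). Claims trade: given a claim $e=(u,v)\in E$, a buyer bank $w$ and a return $\rho$ with $0\le\rho\le\min\{a^{(x)}_w,\ell_e\}$, the post-trade network replaces edge $e$ by an edge $(u,w)$ with the same liability and the same payment function (as a function of $u$'s assets), decreases the external assets of $w$ to $a^{(x)}_w-\rho$ and increases those of $v$ to $a^{(x)}_v+\rho$, leaving everything else unchanged. $\hat{\mathbf{a}}^{\rho}$ denotes the minimal clearing state of the post-trade network. -}

module Defs where

open import Level using (0ℓ)
open import Data.Nat using (ℕ; zero; suc) renaming (_<_ to _<ℕ_; _≤_ to _≤ℕ_)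
open import Data.Fin using (Fin; zero; suc; _≟_)
open import Data.Bool using (Bool; true; false; if_then_else_)
open import Data.Product using (Σ; ∃; _×_; _,_)
open import Relation.Nullary using (¬_; does)
open import Relation.Binary.PropositionalEquality using (_≡_; _≢_)
open import Relation.Binary using (Rel; Decidable)
open import Relation.Binary.Structures using (IsTotalOrder)
open import Algebra.Structures using (IsCommutativeRing)

-- The real numbers, axiomatised as a Dedekind-complete ordered field
-- (agda-stdlib has no reals).  The theorem quantifies over every such
-- structure; the order is assumed decidable (classical reals).

record RealField : Set₁ where
  infixl 6 _+_
  infixl 7 _*_
  infix  4 _≤_
  field
    Carrier : Set
    _+_ _*_ : Carrier → Carrier → Carrier
    -_      : Carrier → Carrier
    0# 1#   : Carrier
    _≤_     : Rel Carrier 0ℓ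
    isCommutativeRing : IsCommutativeRing _≡_ _+_ _*_ -_ 0# 1#
    isTotalOrder      : IsTotalOrder _≡_ _≤_
    _≤?_    : Decidable _≤_
    0≢1     : 0# ≢ 1#
    inverse : ∀ x → x ≢ 0# → Σ Carrier (λ y → x * y ≡ 1#)
    +-mono-≤ : ∀ {x y} z → x ≤ y → x + z ≤ y + z
    *-nonneg : ∀ {x y} → 0# ≤ x → 0# ≤ y → 0# ≤ x * y
    complete : (P : Carrier → Set) → Σ Carrier P →
               Σ Carrier (λ b → ∀ x → P x → x ≤ b) →
               Σ Carrier (λ s → (∀ x → P x → x ≤ s) ×
                                (∀ b → (∀ x → P x → x ≤ b) → s ≤ b))

module RealOps (R : RealField) where
  open RealField R public

  infix 4 _<_
  infixl 6 _-_

  _<_ : Carrier → Carrier → Set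
  x < y = (x ≤ y) × (x ≢ y)

  _-_ : Carrier → Carrier → Carrier
  x - y = x + (- y)

  min : Carrier → Carrier → Carrier
  min x y = if does (x ≤? y) then x else y

  sumFin : ∀ m → (Fin m → Carrier) → Carrier
  sumFin zero    f = 0#
  sumFin (suc m) f = f zero + sumFin m (λ i → f (suc i))

module Networks (R : RealField) where
  open RealOps R public

  record Network (n m : ℕ) : Set where
    field
      debtor   : Fin m → Fin n
      creditor : Fin m → Fin n
      liab     : Fin m → Carrier
      pay      : Fin m → Carrier → Carrier
      ext      : Fin n → Carrier

  module _ {n m : ℕ} (N : Network n m) where
    open Network N

    WellFormed : Set
    WellFormed =
        (∀ e → debtor e ≢ creditor e)
      × (∀ e e' → debtor e ≡ debtor e' → creditor e ≡ creditor e' → e ≡ e')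
      × (∀ e → 0# ≤ liab e)
      × (∀ v → 0# ≤ ext v)

    Lout : Fin n → Carrier
    Lout u = sumFin m (λ e → if does (debtor e ≟ u) then liab e else 0#)

    outPay : Fin n → Carrier → Carrier
    outPay u a = sumFin m (λ e → if does (debtor e ≟ u) then pay e a else 0#)

    inPay : (Fin n → Carrier) → Fin n → Carrier
    inPay a v = sumFin m (λ e → if does (creditor e ≟ v) then pay e (a (debtor e)) else 0#)

    PaymentFunctions : Set
    PaymentFunctions =
        (∀ e a → 0# ≤ a → (0# ≤ pay e a) × (pay e a ≤ liab e))
      × (∀ e a ε → 0# ≤ a → 0# < ε → pay e a ≤ pay e (a + ε))
      × (∀ u a → 0# ≤ a → outPay u a ≡ min a (Lout u))

    -- piecewise-linear: k ≥ 1 (written k = suc k'), borders x₀ … x_k with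
    -- x₀ = 0 < x₁ < … < x_k = L⁺(u), x_{k+1} = ∞, slopes m₁ … m_{k+1} ≥ 0,
    -- p_e(a) = m_i (a - x_{i-1}) + p_e(x_{i-1}) on [x_{i-1}, x_i), i = 1 … k+1
    PiecewiseLinear : Fin m → Set
    PiecewiseLinear e =
      Σ ℕ λ k' → let k = suc k' in
      Σ (ℕ → Carrier) λ x → Σ (ℕ → Carrier) λ sl →
          (x 0 ≡ 0#)
        × (∀ i → i <ℕ k → x i < x (suc i))
        × (x k ≡ Lout (debtor e))
        × (∀ i → i ≤ℕ k → 0# ≤ sl (suc i))
        × (∀ i a → i ≤ℕ k → x i ≤ a → (i <ℕ k → a < x (suc i)) →
             pay e a ≡ sl (suc i) * (a - x i) + pay e (x i))

    StrictlyMonotone : Fin m → Set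
    StrictlyMonotone e =
      ∀ a ε → 0# ≤ a → 0# < ε → ε ≤ liab e - a → pay e a < pay e (a + ε)

    ClearingState : (Fin n → Carrier) → Set
    ClearingState a = (∀ v → 0# ≤ a v) × (∀ v → a v ≡ ext v + inPay a v)

    MinimalClearingState : (Fin n → Carrier) → Set
    MinimalClearingState a =
      ClearingState a × (∀ b → ClearingState b → ∀ v → a v ≤ b v)

  trade : ∀ {n m} → Network n m → Fin m → Fin n → Carrier → Network n m
  trade {n} {m} N e w ρ = record
    { debtor   = debtor
    ; creditor = λ e' → if does (e' ≟ e) then w else creditor e'
    ; liab     = liab
    ; pay      = pay
    ; ext      = λ x → (ext x - (if does (x ≟ w) then ρ else 0#))
                       + (if does (x ≟ creditor e) then ρ else 0#)
    }
    where open Network N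

  AdmissibleReturn : ∀ {n m} → Network n m → Fin m → Fin n → Carrier → Set
  AdmissibleReturn N e w ρ = (0# ≤ ρ) × (ρ ≤ min (Network.ext N w) (Network.liab N e))

-- Let a and b be the minimal clearing states before and after the trade, and suppose the
-- creditor v and the buyer w both gain, so both lie in S = {x | a x < b x}.  Summing the
-- clearing equations over S, the transfer ρ cancels: the total gain of S equals the gain S
-- receives, which is at most the gain S pays out, which is at most the total gain.  Hence
-- every bank y of S passes its whole gain on, b y ≤ L⁺(y), and claims leaving S pay no more
-- under b than under a.  By piecewise linearity all claims of y ∈ S are affine just below b y
-- with slopes summing to 1, and claims leaving S have slope 0.  The slope matrix is thus
-- column-stochastic on S and has a nonnegative fixed vector ψ ≠ 0, and b - tψ is a smaller
-- clearing state of the traded network for small t > 0, contradicting minimality of b.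

module Submission where

open import Defs
open import Level using (0ℓ)
open import Algebra.Bundles using (CommutativeRing; RawRing)
import Algebra.Construct.NaturalChoice.Max as NaturalMax
import Algebra.Construct.NaturalChoice.Min as NaturalMin
import Algebra.Properties.Ring as RingProperties
import Algebra.Properties.Semiring.Mult as SemiringMult
import Algebra.Solver.Ring.AlmostCommutativeRing as ACR
open import Agda.Builtin.Int using (pos; negsuc)
open import Data.Bool using (Bool; true; false; if_then_else_)
open import Data.Empty using (⊥; ⊥-elim)
open import Data.Fin using (Fin; zero; suc; _≟_; punchIn; punchOut)
open import Data.Fin.Properties using (punchIn-punchOut; all?; ¬∀⟶∃¬)
open import Data.Integer as ℤ using (ℤ)
import Data.Integer.Properties as ℤ
open import Data.Maybe using (Maybe; just; nothing)
open import Data.Nat as ℕ using (ℕ; zero; suc; s≤s) renaming (_<_ to _<ℕ_)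
import Data.Nat.Properties as ℕ
open import Data.Product using (Σ; _×_; _,_; proj₁; proj₂)
import Data.Sign as Sign
open import Data.Sum using (inj₁; inj₂)
open import Data.Vec.Functional using (insertAt; foldr)
open import Data.Vec.Functional.Properties using (insertAt-lookup; insertAt-punchIn)
open import Function using (_∘_)
open import Relation.Binary.Bundles using (TotalOrder)
open import Relation.Binary.Definitions using (Decidable)
import Relation.Binary.Construct.NonStrictToStrict as NonStrictToStrict
import Relation.Binary.Properties.Poset as PosetProperties
import Relation.Binary.Properties.TotalOrder as TotalOrderProperties
import Relation.Binary.Reasoning.PartialOrder as PartialOrderReasoning
open import Relation.Binary.PropositionalEquality
  using (_≡_; _≢_; refl; sym; trans; cong; cong₂; subst; subst₂; module ≡-Reasoning)
open import Relation.Nullary using (Dec; does; yes; no; ¬_)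
open import Relation.Nullary.Decidable using (dec-true; dec-false)

module OrderedField (R : RealField) where
  open RealOps R public hiding (+-mono-≤)
  open RealOps R public using () renaming (+-mono-≤ to +-monoˡ-≤)

  commutativeRing : CommutativeRing 0ℓ 0ℓ
  commutativeRing = record { isCommutativeRing = isCommutativeRing }

  open CommutativeRing commutativeRing public
    using ( +-assoc; +-comm; +-identityˡ; +-identityʳ; -‿inverseˡ; -‿inverseʳ
          ; *-assoc; *-comm; *-identityˡ; *-identityʳ; distribˡ; distribʳ; zeroˡ; zeroʳ; ring; semiring)
  open RingProperties ring public
    using (-‿involutive; -0#≈0#; -‿distribˡ-*; -‿distribʳ-*; -‿anti-homo-+; x∙y⁻¹≈ε⇒x≈y; +-cancelʳ)

  totalOrder : TotalOrder 0ℓ 0ℓ 0ℓ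
  totalOrder = record { isTotalOrder = isTotalOrder }

  open TotalOrder totalOrder public using (poset; total)
    renaming (refl to ≤-refl; reflexive to ≤-reflexive; trans to ≤-trans; antisym to ≤-antisym)
  open TotalOrderProperties totalOrder public using (<-irrefl; <⇒≱; ≰⇒≥)

  infix 4 _≡?_ _<?_

  _≡?_ : Decidable {A = Carrier} _≡_
  _≡?_ = PosetProperties.≤-dec⇒≈-dec poset _≤?_

  -- Unlike NonStrictToStrict.<-decidable, this does not unfold, so `with a x <? b x` can abstract it.
  _<?_ : Decidable _<_
  x <? y with x ≤? y | x ≡? y
  ... | yes x≤y | no x≢y  = yes (x≤y , x≢y)
  ... | yes _   | yes x≡y = no (λ x<y → proj₂ x<y x≡y)
  ... | no x≰y  | _       = no (x≰y ∘ proj₁)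

  <⇒≤ : ∀ {x y} → x < y → x ≤ y
  <⇒≤ = proj₁

  module ≤-Reasoning = PartialOrderReasoning poset

  ≮⇒≥ : ∀ {x y} → ¬ (x < y) → y ≤ x
  ≮⇒≥ = NonStrictToStrict.≮⇒≥ _≡_ _≤_ sym _≡?_ ≤-reflexive total

  <-≤-trans : ∀ {x y z} → x < y → y ≤ z → x < z
  <-≤-trans = NonStrictToStrict.<-≤-trans _≡_ _≤_ sym ≤-trans ≤-antisym (λ { refl p → p })

  ≤-<-trans : ∀ {x y z} → x ≤ y → y < z → x < z
  ≤-<-trans = NonStrictToStrict.≤-<-trans _≡_ _≤_ ≤-trans ≤-antisym (λ { refl p → p })

  -- The ring solver needs coefficients whose equality computes, hence ℤ.
  private
    open SemiringMult semiring using (×-homo-+; ×1-homo-*) renaming (_×_ to _×′_)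

    ⟦_⟧ℤ : ℤ → Carrier
    ⟦ pos n ⟧ℤ    = n ×′ 1#
    ⟦ negsuc n ⟧ℤ = - (suc n ×′ 1#)

    ⟦+◃⟧ : ∀ k → ⟦ Sign.+ ℤ.◃ k ⟧ℤ ≡ k ×′ 1#
    ⟦+◃⟧ zero    = refl
    ⟦+◃⟧ (suc k) = refl

    ⟦-◃⟧ : ∀ k → ⟦ Sign.- ℤ.◃ k ⟧ℤ ≡ - (k ×′ 1#)
    ⟦-◃⟧ zero    = sym -0#≈0#
    ⟦-◃⟧ (suc k) = refl

    x-[x+y]≡-y : ∀ x y → x + - (x + y) ≡ - y
    x-[x+y]≡-y x y = begin
      x + - (x + y)    ≡⟨ cong (x +_) (trans (-‿anti-homo-+ x y) (+-comm (- y) (- x))) ⟩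
      x + (- x + - y)  ≡⟨ sym (+-assoc x (- x) (- y)) ⟩
      (x + - x) + - y  ≡⟨ cong (_+ - y) (-‿inverseʳ x) ⟩
      0# + - y         ≡⟨ +-identityˡ (- y) ⟩
      - y              ∎
      where open ≡-Reasoning

    [x+y]-y≡x : ∀ x y → (x + y) + - y ≡ x
    [x+y]-y≡x x y = trans (+-assoc x y (- y)) (trans (cong (x +_) (-‿inverseʳ y)) (+-identityʳ x))

    ⟦-pos⟧ : ∀ k → ⟦ ℤ.- pos k ⟧ℤ ≡ - (k ×′ 1#)
    ⟦-pos⟧ zero    = sym -0#≈0#
    ⟦-pos⟧ (suc k) = refl

    ⟦⊖⟧ : ∀ m n → ⟦ m ℤ.⊖ n ⟧ℤ ≡ m ×′ 1# + - (n ×′ 1#)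
    ⟦⊖⟧ m n with ℕ.≤-<-connex n m
    ... | inj₁ n≤m = begin
      ⟦ m ℤ.⊖ n ⟧ℤ                              ≡⟨ cong ⟦_⟧ℤ (ℤ.⊖-≥ n≤m) ⟩
      (m ℕ.∸ n) ×′ 1#                            ≡⟨ sym ([x+y]-y≡x _ (n ×′ 1#)) ⟩
      ((m ℕ.∸ n) ×′ 1# + n ×′ 1#) + - (n ×′ 1#)  ≡⟨ cong (_+ - (n ×′ 1#)) (sym (×-homo-+ 1# (m ℕ.∸ n) n)) ⟩
      ((m ℕ.∸ n) ℕ.+ n) ×′ 1# + - (n ×′ 1#)      ≡⟨ cong (λ k → k ×′ 1# + - (n ×′ 1#)) (ℕ.m∸n+n≡m n≤m) ⟩
      m ×′ 1# + - (n ×′ 1#)                      ∎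
      where open ≡-Reasoning
    ... | inj₂ m<n = begin
      ⟦ m ℤ.⊖ n ⟧ℤ                               ≡⟨ cong ⟦_⟧ℤ (ℤ.⊖-< m<n) ⟩
      ⟦ ℤ.- pos (n ℕ.∸ m) ⟧ℤ                     ≡⟨ ⟦-pos⟧ (n ℕ.∸ m) ⟩
      - ((n ℕ.∸ m) ×′ 1#)                         ≡⟨ sym (x-[x+y]≡-y (m ×′ 1#) _) ⟩
      m ×′ 1# + - (m ×′ 1# + (n ℕ.∸ m) ×′ 1#)    ≡⟨ cong (λ x → m ×′ 1# + - x) (sym (×-homo-+ 1# m (n ℕ.∸ m))) ⟩
      m ×′ 1# + - ((m ℕ.+ (n ℕ.∸ m)) ×′ 1#)      ≡⟨ cong (λ k → m ×′ 1# + - (k ×′ 1#)) (ℕ.m+[n∸m]≡n (ℕ.<⇒≤ m<n)) ⟩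
      m ×′ 1# + - (n ×′ 1#)                       ∎
      where open ≡-Reasoning

    -x*-y≡x*y : ∀ x y → - x * - y ≡ x * y
    -x*-y≡x*y x y = trans (sym (-‿distribˡ-* x (- y))) (trans (cong -_ (sym (-‿distribʳ-* x y))) (-‿involutive (x * y)))

    ⟦+⟧ : ∀ i j → ⟦ i ℤ.+ j ⟧ℤ ≡ ⟦ i ⟧ℤ + ⟦ j ⟧ℤ
    ⟦+⟧ (pos m)    (pos n)    = ×-homo-+ 1# m n
    ⟦+⟧ (pos m)    (negsuc n) = ⟦⊖⟧ m (suc n)
    ⟦+⟧ (negsuc m) (pos n)    = trans (⟦⊖⟧ n (suc m)) (+-comm _ _)
    ⟦+⟧ (negsuc m) (negsuc n) = begin
      - (suc (suc (m ℕ.+ n)) ×′ 1#)    ≡⟨ cong (λ k → - (suc k ×′ 1#)) (sym (ℕ.+-suc m n)) ⟩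
      - ((suc m ℕ.+ suc n) ×′ 1#)      ≡⟨ cong -_ (×-homo-+ 1# (suc m) (suc n)) ⟩
      - (suc m ×′ 1# + suc n ×′ 1#)    ≡⟨ -‿anti-homo-+ _ _ ⟩
      - (suc n ×′ 1#) + - (suc m ×′ 1#) ≡⟨ +-comm _ _ ⟩
      - (suc m ×′ 1#) + - (suc n ×′ 1#) ∎
      where open ≡-Reasoning

    ⟦*⟧ : ∀ i j → ⟦ i ℤ.* j ⟧ℤ ≡ ⟦ i ⟧ℤ * ⟦ j ⟧ℤ
    ⟦*⟧ (pos m)    (pos n)    = trans (⟦+◃⟧ (m ℕ.* n)) (×1-homo-* m n)
    ⟦*⟧ (pos m)    (negsuc n) = trans (⟦-◃⟧ (m ℕ.* suc n)) (trans (cong -_ (×1-homo-* m (suc n))) (-‿distribʳ-* _ _))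
    ⟦*⟧ (negsuc m) (pos n)    = trans (⟦-◃⟧ (suc m ℕ.* n)) (trans (cong -_ (×1-homo-* (suc m) n)) (-‿distribˡ-* _ _))
    ⟦*⟧ (negsuc m) (negsuc n) = trans (⟦+◃⟧ (suc m ℕ.* suc n)) (trans (×1-homo-* (suc m) (suc n)) (sym (-x*-y≡x*y _ _)))

    ⟦-⟧ : ∀ i → ⟦ ℤ.- i ⟧ℤ ≡ - ⟦ i ⟧ℤ
    ⟦-⟧ (pos n)    = ⟦-pos⟧ n
    ⟦-⟧ (negsuc n) = sym (-‿involutive _)

    ℤ-rawRing : RawRing 0ℓ 0ℓ
    ℤ-rawRing = record
      { Carrier = ℤ ; _≈_ = _≡_ ; _+_ = ℤ._+_ ; _*_ = ℤ._*_ ; -_ = ℤ.-_ ; 0# = pos 0 ; 1# = pos 1 }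

    almostCommutativeRing : ACR.AlmostCommutativeRing 0ℓ 0ℓ
    almostCommutativeRing = ACR.fromCommutativeRing commutativeRing

    ⟦⟧ℤ-homomorphism : ℤ-rawRing ACR.-Raw-AlmostCommutative⟶ almostCommutativeRing
    ⟦⟧ℤ-homomorphism = record
      { ⟦_⟧ = ⟦_⟧ℤ ; +-homo = ⟦+⟧ ; *-homo = ⟦*⟧ ; -‿homo = ⟦-⟧ ; 0-homo = refl ; 1-homo = +-identityʳ 1# }

    ⟦⟧ℤ-equal? : ∀ i j → Maybe (⟦ i ⟧ℤ ≡ ⟦ j ⟧ℤ)
    ⟦⟧ℤ-equal? i j with i ℤ.≟ j
    ... | yes i≡j = just (cong ⟦_⟧ℤ i≡j)
    ... | no _    = nothing

  open import Algebra.Solver.Ring ℤ-rawRing almostCommutativeRing ⟦⟧ℤ-homomorphism ⟦⟧ℤ-equal? public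
    using (solve; _:=_; _:+_; _:*_; :-_; _:-_)

  +-monoʳ-≤ : ∀ z {x y} → x ≤ y → z + x ≤ z + y
  +-monoʳ-≤ z {x} {y} x≤y = subst₂ _≤_ (+-comm x z) (+-comm y z) (+-monoˡ-≤ z x≤y)

  +-mono-≤ : ∀ {x y u v} → x ≤ y → u ≤ v → x + u ≤ y + v
  +-mono-≤ {y = y} {u} x≤y u≤v = ≤-trans (+-monoˡ-≤ u x≤y) (+-monoʳ-≤ y u≤v)

  +-cancelʳ-≤ : ∀ z {x y} → x + z ≤ y + z → x ≤ y
  +-cancelʳ-≤ z {x} {y} le =
    subst₂ _≤_ (solve 2 (λ x z → x :+ z :- z := x) refl x z) (solve 2 (λ y z → y :+ z :- z := y) refl y z)
      (+-monoˡ-≤ (- z) le)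

  +-cancelˡ-≤ : ∀ z {x y} → z + x ≤ z + y → x ≤ y
  +-cancelˡ-≤ z {x} {y} le = +-cancelʳ-≤ z (subst₂ _≤_ (+-comm z x) (+-comm z y) le)

  +-monoˡ-< : ∀ z {x y} → x < y → x + z < y + z
  +-monoˡ-< z (x≤y , x≢y) = +-monoˡ-≤ z x≤y , x≢y ∘ +-cancelʳ z _ _

  +-monoʳ-< : ∀ z {x y} → x < y → z + x < z + y
  +-monoʳ-< z {x} {y} x<y = subst₂ _<_ (+-comm x z) (+-comm y z) (+-monoˡ-< z x<y)

  +-mono-<-≤ : ∀ {x y u v} → x < y → u ≤ v → x + u < y + v
  +-mono-<-≤ {y = y} {u} x<y u≤v = <-≤-trans (+-monoˡ-< u x<y) (+-monoʳ-≤ y u≤v)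

  neg-antimono-≤ : ∀ {x y} → x ≤ y → - y ≤ - x
  neg-antimono-≤ {x} {y} x≤y =
    subst₂ _≤_ (solve 2 (λ x y → x :+ (:- x :+ :- y) := :- y) refl x y) (solve 2 (λ x y → y :+ (:- x :+ :- y) := :- x) refl x y)
      (+-monoˡ-≤ (- x + - y) x≤y)

  x≤y⇒0≤y-x : ∀ {x y} → x ≤ y → 0# ≤ y - x
  x≤y⇒0≤y-x {x} x≤y = subst (_≤ _) (-‿inverseʳ x) (+-monoˡ-≤ (- x) x≤y)

  x≤y⇒x-y≤0 : ∀ {x y} → x ≤ y → x - y ≤ 0#
  x≤y⇒x-y≤0 {y = y} x≤y = subst (_ ≤_) (-‿inverseʳ y) (+-monoˡ-≤ (- y) x≤y)

  0≤y-x⇒x≤y : ∀ {x y} → 0# ≤ y - x → x ≤ y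
  0≤y-x⇒x≤y {x} {y} le = subst₂ _≤_ (+-identityˡ x) (solve 2 (λ x y → y :- x :+ x := y) refl x y) (+-monoˡ-≤ x le)

  x<y⇒0<y-x : ∀ {x y} → x < y → 0# < y - x
  x<y⇒0<y-x {x} x<y = subst (_< _) (-‿inverseʳ x) (+-monoˡ-< (- x) x<y)

  0<y-x⇒x<y : ∀ {x y} → 0# < y - x → x < y
  0<y-x⇒x<y {x} {y} lt = subst₂ _<_ (+-identityˡ x) (solve 2 (λ x y → y :- x :+ x := y) refl x y) (+-monoˡ-< x lt)

  s≤y-x⇒x≤y-s : ∀ {s x y} → s ≤ y - x → x ≤ y - s
  s≤y-x⇒x≤y-s {s} {x} {y} s≤y-x = subst (_≤ y - s) (solve 2 (λ x y → y :- (y :- x) := x) refl x y) (+-monoʳ-≤ y (neg-antimono-≤ s≤y-x))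

  x-y<x : ∀ x {y} → 0# < y → x - y < x
  x-y<x x {y} 0<y = 0<y-x⇒x<y (subst (0# <_) (solve 2 (λ x y → y := x :- (x :- y)) refl x y) 0<y)

  *-monoʳ-≤-nonNeg : ∀ {c x y} → 0# ≤ c → x ≤ y → c * x ≤ c * y
  *-monoʳ-≤-nonNeg {c} {x} {y} 0≤c x≤y = 0≤y-x⇒x≤y
    (subst (0# ≤_) (solve 3 (λ c x y → c :* (y :- x) := c :* y :- c :* x) refl c x y) (*-nonneg 0≤c (x≤y⇒0≤y-x x≤y)))

  x≤0⇒0≤-x : ∀ {x} → x ≤ 0# → 0# ≤ - x
  x≤0⇒0≤-x x≤0 = subst (_≤ _) -0#≈0# (neg-antimono-≤ x≤0)

  0<1 : 0# < 1#
  0<1 with total 0# 1#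
  ... | inj₁ 0≤1 = 0≤1 , 0≢1
  ... | inj₂ 1≤0 = ⊥-elim (0≢1 (≤-antisym 0≤1 1≤0))
    where
      0≤1 : 0# ≤ 1#
      0≤1 = subst (0# ≤_) (trans (sym (-‿distribˡ-* 1# (- 1#))) (trans (cong -_ (*-identityˡ (- 1#))) (-‿involutive 1#)))
              (*-nonneg (x≤0⇒0≤-x 1≤0) (x≤0⇒0≤-x 1≤0))

  x≢0∧x*y≡0⇒y≡0 : ∀ {x y} → x ≢ 0# → x * y ≡ 0# → y ≡ 0#
  x≢0∧x*y≡0⇒y≡0 {x} {y} x≢0 xy≡0 with inverse x x≢0
  ... | x⁻¹ , xx⁻¹≡1 = begin
    y              ≡⟨ sym (*-identityˡ y) ⟩
    1# * y         ≡⟨ cong (_* y) (sym xx⁻¹≡1) ⟩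
    x * x⁻¹ * y    ≡⟨ solve 3 (λ x x⁻¹ y → x :* x⁻¹ :* y := x⁻¹ :* (x :* y)) refl x x⁻¹ y ⟩
    x⁻¹ * (x * y)  ≡⟨ cong (x⁻¹ *_) xy≡0 ⟩
    x⁻¹ * 0#       ≡⟨ zeroʳ x⁻¹ ⟩
    0#             ∎
    where open ≡-Reasoning

  *-pos : ∀ {x y} → 0# < x → 0# < y → 0# < x * y
  *-pos (0≤x , 0≢x) (0≤y , 0≢y) = *-nonneg 0≤x 0≤y , λ 0≡xy → 0≢y (sym (x≢0∧x*y≡0⇒y≡0 (0≢x ∘ sym) (sym 0≡xy)))

  pos-inverse : ∀ {x} → 0# < x → Σ Carrier λ x⁻¹ → (x * x⁻¹ ≡ 1#) × (0# < x⁻¹)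
  pos-inverse {x} (0≤x , 0≢x) with inverse x (0≢x ∘ sym)
  ... | x⁻¹ , xx⁻¹≡1 = x⁻¹ , xx⁻¹≡1 , 0<x⁻¹
    where
      x⁻¹≢0 : x⁻¹ ≢ 0#
      x⁻¹≢0 x⁻¹≡0 = 0≢1 (trans (sym (zeroʳ x)) (trans (cong (x *_) (sym x⁻¹≡0)) xx⁻¹≡1))
      0<x⁻¹ : 0# < x⁻¹
      0<x⁻¹ with total 0# x⁻¹
      ... | inj₁ 0≤x⁻¹ = 0≤x⁻¹ , x⁻¹≢0 ∘ sym
      ... | inj₂ x⁻¹≤0 = ⊥-elim (<⇒≱ 0<1 (subst₂ _≤_ xx⁻¹≡1 (zeroʳ x) (*-monoʳ-≤-nonNeg 0≤x x⁻¹≤0)))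

  *-cancelʳ-≡ : ∀ {d x y} → d ≢ 0# → x * d ≡ y * d → x ≡ y
  *-cancelʳ-≡ {d} {x} {y} d≢0 xd≡yd = x∙y⁻¹≈ε⇒x≈y _ _ (x≢0∧x*y≡0⇒y≡0 d≢0 (begin
    d * (x - y)      ≡⟨ solve 3 (λ d x y → d :* (x :- y) := x :* d :- y :* d) refl d x y ⟩
    x * d - y * d    ≡⟨ cong (_- y * d) xd≡yd ⟩
    y * d - y * d    ≡⟨ -‿inverseʳ (y * d) ⟩
    0#               ∎))
    where open ≡-Reasoning

  x-y≡x⇒y≡0 : ∀ {x y} → x - y ≡ x → y ≡ 0#
  x-y≡x⇒y≡0 {x} {y} x-y≡x = begin
    y              ≡⟨ solve 2 (λ x y → y := x :- (x :- y)) refl x y ⟩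
    x - (x - y)    ≡⟨ cong (λ u → x - u) x-y≡x ⟩
    x - x          ≡⟨ -‿inverseʳ x ⟩
    0#             ∎
    where open ≡-Reasoning

  x-0≡x : ∀ x → x - 0# ≡ x
  x-0≡x x = trans (cong (x +_) -0#≈0#) (+-identityʳ x)

  x-y*0≡x : ∀ x y → x - y * 0# ≡ x
  x-y*0≡x x y = trans (cong (λ u → x - u) (zeroʳ y)) (x-0≡x x)

  x-0*y≡x : ∀ x y → x - 0# * y ≡ x
  x-0*y≡x x y = trans (cong (λ u → x - u) (zeroˡ y)) (x-0≡x x)

  *-monoˡ-≤-nonNeg : ∀ {c x y} → 0# ≤ c → x ≤ y → x * c ≤ y * c
  *-monoˡ-≤-nonNeg {c} {x} {y} 0≤c x≤y = subst₂ _≤_ (*-comm c x) (*-comm c y) (*-monoʳ-≤-nonNeg 0≤c x≤y)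

  x<x+1 : ∀ x → x < x + 1#
  x<x+1 x = subst (_< x + 1#) (+-identityʳ x) (+-monoʳ-< x 0<1)

  half : Σ Carrier λ h → (h + h ≡ 1#) × (0# < h)
  half = halve (pos-inverse (subst (_< 1# + 1#) (+-identityʳ 0#) (+-mono-<-≤ 0<1 (<⇒≤ 0<1))))
    where
      halve : Σ Carrier (λ h → ((1# + 1#) * h ≡ 1#) × (0# < h)) → Σ Carrier λ h → (h + h ≡ 1#) × (0# < h)
      halve (h , 2h≡1 , 0<h) = h , h+h≡1 , 0<h
        where
          h+h≡1 : h + h ≡ 1#
          h+h≡1 = begin
            h + h              ≡⟨ sym (cong₂ _+_ (*-identityˡ h) (*-identityˡ h)) ⟩
            1# * h + 1# * h    ≡⟨ sym (distribʳ h 1# 1#) ⟩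
            (1# + 1#) * h      ≡⟨ 2h≡1 ⟩
            1#                 ∎
            where open ≡-Reasoning

  midpoint-between : ∀ {h x y} → h + h ≡ 1# → 0# < h → x < y → (x < (x + y) * h) × ((x + y) * h < y)
  midpoint-between {h} {x} {y} h+h≡1 0<h x<y =
    0<y-x⇒x<y (subst (0# <_) (sym z-x≡) 0<[y-x]h) , 0<y-x⇒x<y (subst (0# <_) (sym y-z≡) 0<[y-x]h)
    where
      open ≡-Reasoning
      0<[y-x]h : 0# < (y - x) * h
      0<[y-x]h = *-pos (x<y⇒0<y-x x<y) 0<h
      z-x≡ : (x + y) * h - x ≡ (y - x) * h
      z-x≡ = begin
        (x + y) * h - x              ≡⟨ cong (λ u → (x + y) * h - u) (sym (trans (cong (x *_) h+h≡1) (*-identityʳ x))) ⟩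
        (x + y) * h - x * (h + h)    ≡⟨ solve 3 (λ x y h → (x :+ y) :* h :- x :* (h :+ h) := (y :- x) :* h) refl x y h ⟩
        (y - x) * h                  ∎
      y-z≡ : y - (x + y) * h ≡ (y - x) * h
      y-z≡ = begin
        y - (x + y) * h              ≡⟨ cong (_- (x + y) * h) (sym (trans (cong (y *_) h+h≡1) (*-identityʳ y))) ⟩
        y * (h + h) - (x + y) * h    ≡⟨ solve 3 (λ x y h → y :* (h :+ h) :- (x :+ y) :* h := (y :- x) :* h) refl x y h ⟩
        (y - x) * h                  ∎

  between : ∀ {x y} → x < y → Σ Carrier λ z → (x < z) × (z < y)
  between x<y = _ , midpoint-between (proj₁ (proj₂ half)) (proj₂ (proj₂ half)) x<y

module Extrema (R : RealField) where
  open OrderedField R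
  open NaturalMin totalOrder public using (_⊓_; x⊓y≤x; x⊓y≤y; ⊓-sel)
  open NaturalMax totalOrder public using (_⊔_; x≤x⊔y; x≤y⊔x; ⊔-lub; ⊔-sel)

  <-⊓ : ∀ {z x y} → z < x → z < y → z < x ⊓ y
  <-⊓ {z} {x} {y} z<x z<y with ⊓-sel x y
  ... | inj₁ x⊓y≡x = subst (z <_) (sym x⊓y≡x) z<x
  ... | inj₂ x⊓y≡y = subst (z <_) (sym x⊓y≡y) z<y

  ⊔-< : ∀ {x y z} → x < z → y < z → x ⊔ y < z
  ⊔-< {x} {y} {z} x<z y<z with ⊔-sel x y
  ... | inj₁ x⊔y≡x = subst (_< z) (sym x⊔y≡x) x<z
  ... | inj₂ x⊔y≡y = subst (_< z) (sym x⊔y≡y) y<z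

  x≤foldr-⊔ : ∀ {k} x (c : Fin k → Carrier) → x ≤ foldr _⊔_ x c
  x≤foldr-⊔ {zero}  x c = ≤-refl
  x≤foldr-⊔ {suc k} x c = ≤-trans (x≤foldr-⊔ x (c ∘ suc)) (x≤y⊔x (c zero) _)

  c≤foldr-⊔ : ∀ {k} x (c : Fin k → Carrier) i → c i ≤ foldr _⊔_ x c
  c≤foldr-⊔ x c zero    = x≤x⊔y (c zero) _
  c≤foldr-⊔ x c (suc i) = ≤-trans (c≤foldr-⊔ x (c ∘ suc) i) (x≤y⊔x (c zero) _)

  foldr-⊔-< : ∀ {k t} x (c : Fin k → Carrier) → x < t → (∀ i → c i < t) → foldr _⊔_ x c < t
  foldr-⊔-< {zero}  x c x<t c<t = x<t
  foldr-⊔-< {suc k} x c x<t c<t = ⊔-< (c<t zero) (foldr-⊔-< x (c ∘ suc) x<t (c<t ∘ suc))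

  ∣_∣ : Carrier → Carrier
  ∣ x ∣ = x ⊔ - x

  x≤∣x∣ : ∀ x → x ≤ ∣ x ∣
  x≤∣x∣ x = x≤x⊔y x (- x)

  -x≤∣x∣ : ∀ x → - x ≤ ∣ x ∣
  -x≤∣x∣ x = x≤y⊔x x (- x)

  ∣x∣≤t : ∀ {x t} → x ≤ t → - x ≤ t → ∣ x ∣ ≤ t
  ∣x∣≤t = ⊔-lub

  0≤∣x∣ : ∀ x → 0# ≤ ∣ x ∣
  0≤∣x∣ x with total 0# x
  ... | inj₁ 0≤x = ≤-trans 0≤x (x≤∣x∣ x)
  ... | inj₂ x≤0 = ≤-trans (x≤0⇒0≤-x x≤0) (-x≤∣x∣ x)

  ∣x∣≢0 : ∀ {x} → x ≢ 0# → ∣ x ∣ ≢ 0#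
  ∣x∣≢0 {x} x≢0 ∣x∣≡0 = x≢0 (≤-antisym x≤0 (subst (0# ≤_) (-‿involutive x) (x≤0⇒0≤-x -x≤0)))
    where
      x≤0  = subst (x ≤_) ∣x∣≡0 (x≤∣x∣ x)
      -x≤0 = subst (- x ≤_) ∣x∣≡0 (-x≤∣x∣ x)

  min≡ˡ : ∀ {x c} → x ≤ c → min x c ≡ x
  min≡ˡ {x} {c} x≤c with x ≤? c
  ... | yes _  = refl
  ... | no x≰c = ⊥-elim (x≰c x≤c)

  min-sub-min≤sub : ∀ {x y} c → x ≤ y → min y c - min x c ≤ y - x
  min-sub-min≤sub {x} {y} c x≤y with y ≤? c | x ≤? c
  ... | yes _   | yes _   = ≤-refl
  ... | yes y≤c | no x≰c  = ⊥-elim (x≰c (≤-trans x≤y y≤c))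
  ... | no y≰c  | yes _   = +-monoˡ-≤ (- x) (≰⇒≥ y≰c)
  ... | no _    | no _    = subst (_≤ y - x) (sym (-‿inverseʳ c)) (x≤y⇒0≤y-x x≤y)

  min-sub-min<sub : ∀ {x y} c → x < y → c < y → min y c - min x c < y - x
  min-sub-min<sub {x} {y} c x<y c<y with y ≤? c | x ≤? c
  ... | yes y≤c | _      = ⊥-elim (<⇒≱ c<y y≤c)
  ... | no _    | yes _  = +-monoˡ-< (- x) c<y
  ... | no _    | no _   = subst (_< y - x) (sym (-‿inverseʳ c)) (x<y⇒0<y-x x<y)

module Approximation (R : RealField) where
  open OrderedField R
  open Extrema R

  affine-fixing-two-points : ∀ {α β z₁ z₂} → z₁ ≢ z₂ → α * z₁ + β ≡ z₁ → α * z₂ + β ≡ z₂ → (α ≡ 1#) × (β ≡ 0#)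
  affine-fixing-two-points {α} {β} {z₁} {z₂} z₁≢z₂ fix₁ fix₂ = α≡1 , β≡0
    where
      open ≡-Reasoning
      α≡1 : α ≡ 1#
      α≡1 = *-cancelʳ-≡ (z₁≢z₂ ∘ sym ∘ x∙y⁻¹≈ε⇒x≈y _ _) (begin
        α * (z₂ - z₁)
          ≡⟨ solve 4 (λ α β z₁ z₂ → α :* (z₂ :- z₁) := (α :* z₂ :+ β) :- (α :* z₁ :+ β)) refl α β z₁ z₂ ⟩
        (α * z₂ + β) - (α * z₁ + β)    ≡⟨ cong₂ _-_ fix₂ fix₁ ⟩
        z₂ - z₁                        ≡⟨ sym (*-identityˡ _) ⟩
        1# * (z₂ - z₁)                 ∎)
      β≡0 : β ≡ 0#
      β≡0 = begin
        β                      ≡⟨ solve 3 (λ α β z → β := (α :* z :+ β) :- α :* z) refl α β z₁ ⟩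
        (α * z₁ + β) - α * z₁  ≡⟨ cong₂ (λ u a → u - a * z₁) fix₁ α≡1 ⟩
        z₁ - 1# * z₁           ≡⟨ cong (λ u → z₁ - u) (*-identityˡ z₁) ⟩
        z₁ - z₁                ≡⟨ -‿inverseʳ z₁ ⟩
        0#                     ∎

  ≤-of-≤-minus-small : ∀ {h σ V P} → 0# < h → 0# ≤ σ → (∀ s → 0# < s → s ≤ h → V - σ * s ≤ P) → V ≤ P
  ≤-of-≤-minus-small {h} {σ} {V} {P} 0<h 0≤σ below = ≮⇒≥ refute
    where
      refute : ¬ (P < V)
      refute P<V = witness (pos-inverse 0<Q)
        where
          D = V - P
          0<D : 0# < D
          0<D = x<y⇒0<y-x P<V
          0≤σh : 0# ≤ σ * h
          0≤σh = *-nonneg 0≤σ (<⇒≤ 0<h)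
          Q = D + σ * h
          0<Q : 0# < Q
          0<Q = subst (_< Q) (+-identityʳ 0#) (+-mono-<-≤ 0<D 0≤σh)
          witness : Σ Carrier (λ ι → (Q * ι ≡ 1#) × (0# < ι)) → ⊥
          witness (ι , Qι≡1 , 0<ι) = <⇒≱ P<V-σs (below s 0<s s≤h)
            where
              open ≡-Reasoning
              -- s = h D / (D + σ h) lies in (0, h] and σ s < D
              s = h * (D * ι)
              0<s : 0# < s
              0<s = *-pos 0<h (*-pos 0<D 0<ι)
              Dι≤1 : D * ι ≤ 1#
              Dι≤1 = subst (D * ι ≤_) Qι≡1 (*-monoˡ-≤-nonNeg (<⇒≤ 0<ι) (subst (_≤ Q) (+-identityʳ D) (+-monoʳ-≤ D 0≤σh)))
              s≤h : s ≤ h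
              s≤h = subst (s ≤_) (*-identityʳ h) (*-monoʳ-≤-nonNeg (<⇒≤ 0<h) Dι≤1)
              excess : (V - σ * s) - P ≡ D * D * ι
              excess = begin
                (V - σ * s) - P      ≡⟨ solve 3 (λ V σs P → (V :- σs) :- P := (V :- P) :- σs) refl V (σ * s) P ⟩
                D - σ * s            ≡⟨ cong (_- σ * s) (sym (trans (cong (D *_) Qι≡1) (*-identityʳ D))) ⟩
                D * (Q * ι) - σ * s
                  ≡⟨ solve 4 (λ D σ h ι → D :* ((D :+ σ :* h) :* ι) :- σ :* (h :* (D :* ι)) := D :* D :* ι) refl D σ h ι ⟩
                D * D * ι            ∎
              P<V-σs : P < V - σ * s
              P<V-σs = 0<y-x⇒x<y (subst (0# <_) (sym excess) (*-pos (*-pos 0<D 0<D) 0<ι))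

  small-multiple-below : ∀ {g x} → 0# < g → 0# ≤ x → Σ Carrier λ t → (0# < t) × (t * x ≤ g)
  small-multiple-below {g} {x} 0<g 0≤x = scale (pos-inverse (≤-<-trans 0≤x (x<x+1 x)))
    where
      scale : Σ Carrier (λ ι → ((x + 1#) * ι ≡ 1#) × (0# < ι)) → Σ Carrier λ t → (0# < t) × (t * x ≤ g)
      scale (ι , [x+1]ι≡1 , 0<ι) = g * ι , *-pos 0<g 0<ι , gιx≤g
        where
          xι≤1 : x * ι ≤ 1#
          xι≤1 = subst (x * ι ≤_) [x+1]ι≡1 (*-monoˡ-≤-nonNeg (<⇒≤ 0<ι) (<⇒≤ (x<x+1 x)))
          gιx≤g : g * ι * x ≤ g
          gιx≤g = subst₂ _≤_ (solve 3 (λ g ι x → g :* (x :* ι) := g :* ι :* x) refl g ι x) (*-identityʳ g)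
                    (*-monoʳ-≤-nonNeg (<⇒≤ 0<g) xι≤1)

  uniform-small-multiple : ∀ k (g x : Fin k → Carrier) → (∀ i → 0# < g i) → (∀ i → 0# ≤ x i) →
                           Σ Carrier λ t → (0# < t) × (∀ i → t * x i ≤ g i)
  uniform-small-multiple zero    g x 0<g 0≤x = 1# , 0<1 , λ ()
  uniform-small-multiple (suc k) g x 0<g 0≤x =
    combine (small-multiple-below (0<g zero) (0≤x zero)) (uniform-small-multiple k (g ∘ suc) (x ∘ suc) (0<g ∘ suc) (0≤x ∘ suc))
    where
      combine : Σ Carrier (λ t → (0# < t) × (t * x zero ≤ g zero)) → Σ Carrier (λ t → (0# < t) × (∀ i → t * x (suc i) ≤ g (suc i))) →
                Σ Carrier λ t → (0# < t) × (∀ i → t * x i ≤ g i)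
      combine (t₀ , 0<t₀ , t₀x≤g) (t , 0<t , tx≤g) = t₀ ⊓ t , <-⊓ 0<t₀ 0<t , bound
        where
          bound : ∀ i → (t₀ ⊓ t) * x i ≤ g i
          bound zero    = ≤-trans (*-monoˡ-≤-nonNeg (0≤x zero) (x⊓y≤x t₀ t)) t₀x≤g
          bound (suc i) = ≤-trans (*-monoˡ-≤-nonNeg (0≤x (suc i)) (x⊓y≤y t₀ t)) (tx≤g i)

  crossing : ∀ k (x : ℕ → Carrier) {t} → x 0 < t → t ≤ x k → Σ ℕ λ i → (i <ℕ k) × (x i < t) × (t ≤ x (suc i))
  crossing zero    x x₀<t t≤x₀ = ⊥-elim (<⇒≱ x₀<t t≤x₀)
  crossing (suc k) x {t} x₀<t t≤xₖ₊₁ with x k <? t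
  ... | yes xₖ<t = k , ℕ.n<1+n k , xₖ<t , t≤xₖ₊₁
  ... | no xₖ≮t  = let i , i<k , crossesᵢ = crossing k x x₀<t (≮⇒≥ xₖ≮t) in i , ℕ.m<n⇒m<1+n i<k , crossesᵢ

module FiniteSums (R : RealField) where
  open OrderedField R

  sum-cong : ∀ {k} {f g : Fin k → Carrier} → (∀ i → f i ≡ g i) → sumFin k f ≡ sumFin k g
  sum-cong {zero}  f≗g = refl
  sum-cong {suc k} f≗g = cong₂ _+_ (f≗g zero) (sum-cong (f≗g ∘ suc))

  sum-zero : ∀ {k} {f : Fin k → Carrier} → (∀ i → f i ≡ 0#) → sumFin k f ≡ 0#
  sum-zero {zero}  f≗0 = refl
  sum-zero {suc k} f≗0 = trans (cong₂ _+_ (f≗0 zero) (sum-zero (f≗0 ∘ suc))) (+-identityʳ 0#)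

  sum-+ : ∀ {k} (f g : Fin k → Carrier) → sumFin k (λ i → f i + g i) ≡ sumFin k f + sumFin k g
  sum-+ {zero}  f g = sym (+-identityʳ 0#)
  sum-+ {suc k} f g = trans (cong (f zero + g zero +_) (sum-+ (f ∘ suc) (g ∘ suc)))
    (solve 4 (λ a b c d → (a :+ b) :+ (c :+ d) := (a :+ c) :+ (b :+ d)) refl (f zero) (g zero) _ _)

  sum-*ˡ : ∀ {k} c (f : Fin k → Carrier) → sumFin k (λ i → c * f i) ≡ c * sumFin k f
  sum-*ˡ {zero}  c f = sym (zeroʳ c)
  sum-*ˡ {suc k} c f = trans (cong (c * f zero +_) (sum-*ˡ c (f ∘ suc))) (sym (distribˡ c (f zero) _))

  sum-*ʳ : ∀ {k} c (f : Fin k → Carrier) → sumFin k (λ i → f i * c) ≡ sumFin k f * c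
  sum-*ʳ c f = trans (sum-cong (λ i → *-comm (f i) c)) (trans (sum-*ˡ c f) (*-comm c _))

  sum-neg : ∀ {k} (f : Fin k → Carrier) → sumFin k (λ i → - f i) ≡ - sumFin k f
  sum-neg {zero}  f = sym -0#≈0#
  sum-neg {suc k} f = trans (cong (- f zero +_) (sum-neg (f ∘ suc))) (solve 2 (λ x y → :- x :+ :- y := :- (x :+ y)) refl (f zero) _)

  sum-- : ∀ {k} (f g : Fin k → Carrier) → sumFin k (λ i → f i - g i) ≡ sumFin k f - sumFin k g
  sum-- f g = trans (sum-+ f (λ i → - g i)) (cong (sumFin _ f +_) (sum-neg g))

  sum-comm : ∀ {k l} (f : Fin k → Fin l → Carrier) →
             sumFin k (λ i → sumFin l (f i)) ≡ sumFin l (λ j → sumFin k (λ i → f i j))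
  sum-comm {zero} {l} f = sym (sum-zero {l} (λ _ → refl))
  sum-comm {suc k} f = trans (cong (sumFin _ (f zero) +_) (sum-comm (f ∘ suc))) (sym (sum-+ (f zero) _))

  sum-punchIn : ∀ {k} (p : Fin (suc k)) (f : Fin (suc k) → Carrier) → sumFin (suc k) f ≡ f p + sumFin k (f ∘ punchIn p)
  sum-punchIn         zero    f = refl
  sum-punchIn {suc k} (suc p) f = trans (cong (f zero +_) (sum-punchIn p (f ∘ suc)))
    (solve 3 (λ a b c → a :+ (b :+ c) := b :+ (a :+ c)) refl (f zero) (f (suc p)) _)

  sum-indicator : ∀ {k} (c : Fin k) (g : Fin k → Carrier) → sumFin k (λ i → if does (c ≟ i) then g i else 0#) ≡ g c
  sum-indicator {suc k} zero    g = trans (cong (g zero +_) (sum-zero {k} (λ _ → refl))) (+-identityʳ _)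
  sum-indicator {suc k} (suc c) g = trans (+-identityˡ _) (sum-indicator c (g ∘ suc))

  sum-indicator′ : ∀ {k} (c : Fin k) (g : Fin k → Carrier) → sumFin k (λ i → if does (i ≟ c) then g i else 0#) ≡ g c
  sum-indicator′ {suc k} zero    g = trans (cong (g zero +_) (sum-zero {k} (λ _ → refl))) (+-identityʳ _)
  sum-indicator′ {suc k} (suc c) g = trans (+-identityˡ _) (sum-indicator′ c (g ∘ suc))

  sum-fibres : ∀ {k l} (c : Fin l → Fin k) (G : Fin k → Fin l → Carrier) →
               sumFin k (λ x → sumFin l (λ f → if does (c f ≟ x) then G x f else 0#)) ≡ sumFin l (λ f → G (c f) f)
  sum-fibres {k} {l} c G = trans (sum-comm {k} {l} (λ x f → if does (c f ≟ x) then G x f else 0#))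
                                 (sum-cong (λ f → sum-indicator (c f) (λ x → G x f)))

  sum-mono-≤ : ∀ {k} {f g : Fin k → Carrier} → (∀ i → f i ≤ g i) → sumFin k f ≤ sumFin k g
  sum-mono-≤ {zero}  f≤g = ≤-refl
  sum-mono-≤ {suc k} f≤g = +-mono-≤ (f≤g zero) (sum-mono-≤ (f≤g ∘ suc))

  sum-nonneg : ∀ {k} {f : Fin k → Carrier} → (∀ i → 0# ≤ f i) → 0# ≤ sumFin k f
  sum-nonneg {k} {f} f≥0 = subst (_≤ sumFin k f) (sum-zero {k} (λ _ → refl)) (sum-mono-≤ f≥0)

  sum-mono-tight : ∀ {k} {f g : Fin k → Carrier} → (∀ i → f i ≤ g i) → sumFin k g ≤ sumFin k f → ∀ i → f i ≡ g i
  sum-mono-tight {suc k} {f} {g} f≤g Σg≤Σf = pointwise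
    where
      tail≤ : sumFin k (g ∘ suc) ≤ sumFin k (f ∘ suc)
      tail≤ = +-cancelˡ-≤ (g zero) (≤-trans Σg≤Σf (+-monoˡ-≤ _ (f≤g zero)))
      pointwise : ∀ i → f i ≡ g i
      pointwise zero    = ≤-antisym (f≤g zero) (+-cancelʳ-≤ _ (≤-trans Σg≤Σf (+-monoʳ-≤ (f zero) (sum-mono-≤ (f≤g ∘ suc)))))
      pointwise (suc i) = sum-mono-tight (f≤g ∘ suc) tail≤ i

  if-+ : ∀ (B : Bool) u v → (if B then u + v else 0#) ≡ (if B then u else 0#) + (if B then v else 0#)
  if-+ true  u v = refl
  if-+ false u v = sym (+-identityʳ 0#)

  if-- : ∀ (B : Bool) u v → (if B then u - v else 0#) ≡ (if B then u else 0#) - (if B then v else 0#)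
  if-- true  u v = refl
  if-- false u v = sym (-‿inverseʳ 0#)

  if-*ʳ : ∀ (B : Bool) u c → (if B then u else 0#) * c ≡ (if B then u * c else 0#)
  if-*ʳ true  u c = refl
  if-*ʳ false u c = zeroˡ c

  if-swap : ∀ (B B′ : Bool) u → (if B then (if B′ then u else 0#) else 0#) ≡ (if B′ then (if B then u else 0#) else 0#)
  if-swap true  B′    u = refl
  if-swap false true  u = refl
  if-swap false false u = refl

  if-yes : ∀ {A : Set} (a? : Dec A) → A → ∀ {u′ : Carrier} u → (if does a? then u else u′) ≡ u
  if-yes a? x {u′} u = cong (λ B → if B then u else u′) (dec-true a? x)

  if-no : ∀ {A : Set} (a? : Dec A) → ¬ A → ∀ {u′ : Carrier} u → (if does a? then u else u′) ≡ u′
  if-no a? ¬x {u′} u = cong (λ B → if B then u else u′) (dec-false a? ¬x)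

  if-≤ : ∀ (B : Bool) {u} → 0# ≤ u → (if B then u else 0#) ≤ u
  if-≤ true  0≤u = ≤-refl
  if-≤ false 0≤u = 0≤u

  if-≤0 : ∀ (B : Bool) {u} → u ≤ 0# → (if B then u else 0#) ≤ 0#
  if-≤0 true  u≤0 = u≤0
  if-≤0 false u≤0 = ≤-refl

  if-nonneg : ∀ (B : Bool) {u} → 0# ≤ u → 0# ≤ (if B then u else 0#)
  if-nonneg true  0≤u = 0≤u
  if-nonneg false 0≤u = ≤-refl

  if-sum : ∀ (B : Bool) {k} (g : Fin k → Carrier) → (if B then sumFin k g else 0#) ≡ sumFin k (λ i → if B then g i else 0#)
  if-sum true  g = refl
  if-sum false {k} g = sym (sum-zero {k} (λ _ → refl))

module LinearAlgebra (R : RealField) where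
  open OrderedField R
  open Extrema R
  open FiniteSums R

  infixr 7 _·_

  _·_ : ∀ {k l} → (Fin k → Fin l → Carrier) → (Fin l → Carrier) → Fin k → Carrier
  (A · φ) i = sumFin _ (λ j → A i j * φ j)

  Nontrivial : ∀ {l} → (Fin l → Carrier) → Set
  Nontrivial φ = Σ (Fin _) λ j → φ j ≢ 0#

  NontrivialSolution : ∀ {k l} → (Fin k → Fin l → Carrier) → Set
  NontrivialSolution A = Σ (Fin _ → Carrier) λ φ → Nontrivial φ × (∀ i → (A · φ) i ≡ 0#)

  ·-insertAt : ∀ {k l} (A : Fin k → Fin (suc l) → Carrier) (φ : Fin l → Carrier) p v i →
               (A · insertAt φ p v) i ≡ A i p * v + sumFin l (λ j → A i (punchIn p j) * φ j)
  ·-insertAt A φ p v i = trans (sum-punchIn p (λ j → A i j * insertAt φ p v j))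
    (cong₂ _+_ (cong (A i p *_) (insertAt-lookup φ p v)) (sum-cong (λ j → cong (A i (punchIn p j) *_) (insertAt-punchIn φ p v j))))

  module PivotElimination {k l} (A : Fin (suc k) → Fin (suc l) → Carrier) (p : Fin (suc l))
                          (c⁻¹ : Carrier) (cc⁻¹≡1 : A zero p * c⁻¹ ≡ 1#) where

    reduced : Fin k → Fin l → Carrier
    reduced i j = A (suc i) (punchIn p j) - A (suc i) p * c⁻¹ * A zero (punchIn p j)

    lift : NontrivialSolution reduced → NontrivialSolution A
    lift (φ′ , (j , φ′j≢0) , reduced·φ′≡0) =
      φ , (punchIn p j , subst (_≢ 0#) (sym (insertAt-punchIn φ′ p _ j)) φ′j≢0) , solves
      where
        open ≡-Reasoning
        T : (Fin (suc l) → Carrier) → Carrier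
        T r = sumFin l (λ j → r (punchIn p j) * φ′ j)
        T₀ = T (A zero)
        φ = insertAt φ′ p (- (c⁻¹ * T₀))

        T-row : ∀ i → T (A (suc i)) ≡ A (suc i) p * c⁻¹ * T₀
        T-row i = x∙y⁻¹≈ε⇒x≈y _ _ (begin
          T (A (suc i)) - a * c⁻¹ * T₀
            ≡⟨ cong (λ u → T (A (suc i)) - u) (sym (sum-*ˡ (a * c⁻¹) (λ j → A zero (punchIn p j) * φ′ j))) ⟩
          T (A (suc i)) - sumFin l (λ j → a * c⁻¹ * (A zero (punchIn p j) * φ′ j))
            ≡⟨ sym (sum-- (λ j → A (suc i) (punchIn p j) * φ′ j) (λ j → a * c⁻¹ * (A zero (punchIn p j) * φ′ j))) ⟩
          sumFin l (λ j → A (suc i) (punchIn p j) * φ′ j - a * c⁻¹ * (A zero (punchIn p j) * φ′ j))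
            ≡⟨ sum-cong (λ j → solve 4 (λ x y z φ → x :* φ :- y :* (z :* φ) := (x :- y :* z) :* φ) refl
                                          (A (suc i) (punchIn p j)) (a * c⁻¹) (A zero (punchIn p j)) (φ′ j)) ⟩
          (reduced · φ′) i
            ≡⟨ reduced·φ′≡0 i ⟩
          0# ∎)
          where a = A (suc i) p

        solves : ∀ i → (A · φ) i ≡ 0#
        solves zero = begin
          (A · φ) zero                         ≡⟨ ·-insertAt A φ′ p _ zero ⟩
          A zero p * (- (c⁻¹ * T₀)) + T₀
            ≡⟨ solve 3 (λ c c⁻¹ t → c :* (:- (c⁻¹ :* t)) :+ t := :- (c :* c⁻¹ :* t) :+ t) refl (A zero p) c⁻¹ T₀ ⟩
          - (A zero p * c⁻¹ * T₀) + T₀         ≡⟨ cong (λ u → - (u * T₀) + T₀) cc⁻¹≡1 ⟩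
          - (1# * T₀) + T₀                     ≡⟨ cong (λ u → - u + T₀) (*-identityˡ T₀) ⟩
          - T₀ + T₀                            ≡⟨ -‿inverseˡ T₀ ⟩
          0#                                   ∎
        solves (suc i) = begin
          (A · φ) (suc i)                        ≡⟨ ·-insertAt A φ′ p _ (suc i) ⟩
          a * (- (c⁻¹ * T₀)) + T (A (suc i))     ≡⟨ cong₂ _+_ (sym (-‿distribʳ-* a (c⁻¹ * T₀))) (trans (T-row i) (*-assoc a c⁻¹ T₀)) ⟩
          - (a * (c⁻¹ * T₀)) + a * (c⁻¹ * T₀)    ≡⟨ -‿inverseˡ _ ⟩
          0#                                     ∎
          where a = A (suc i) p

  underdetermined-solution : ∀ {k l} → k <ℕ l → (A : Fin k → Fin l → Carrier) → NontrivialSolution A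
  underdetermined-solution {zero}  {suc l} _ A = (λ _ → 1#) , (zero , 0≢1 ∘ sym) , λ ()
  underdetermined-solution {suc k} {suc l} (s≤s k<l) A with all? (λ j → A zero j ≡? 0#)
  ... | yes row₀≡0 = zero-row (underdetermined-solution (ℕ.m<n⇒m<1+n k<l) (A ∘ suc))
    where
      zero-row : NontrivialSolution (A ∘ suc) → NontrivialSolution A
      zero-row (φ , φ≢0 , Aφ≡0) = φ , φ≢0 , λ
        { zero    → sum-zero (λ j → trans (cong (_* φ j) (row₀≡0 j)) (zeroˡ (φ j)))
        ; (suc i) → Aφ≡0 i }
  ... | no row₀≢0 with ¬∀⟶∃¬ _ _ (λ j → A zero j ≡? 0#) row₀≢0
  ...   | p , c≢0 with inverse (A zero p) c≢0
  ...     | c⁻¹ , cc⁻¹≡1 = lift (underdetermined-solution k<l reduced)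
    where open PivotElimination A p c⁻¹ cc⁻¹≡1

  sum-*-· : ∀ {k l} (u : Fin k → Carrier) (A : Fin k → Fin l → Carrier) (φ : Fin l → Carrier) →
            sumFin k (λ i → u i * (A · φ) i) ≡ sumFin l (λ j → sumFin k (λ i → u i * A i j) * φ j)
  sum-*-· {k} {l} u A φ = begin
    sumFin k (λ i → u i * (A · φ) i)                    ≡⟨ sum-cong (λ i → sym (sum-*ˡ (u i) (λ j → A i j * φ j))) ⟩
    sumFin k (λ i → sumFin l (λ j → u i * (A i j * φ j))) ≡⟨ sum-comm (λ i j → u i * (A i j * φ j)) ⟩
    sumFin l (λ j → sumFin k (λ i → u i * (A i j * φ j))) ≡⟨ sum-cong (λ j → trans (sum-cong (λ i → sym (*-assoc (u i) (A i j) (φ j))))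
                                                                               (sum-*ʳ (φ j) (λ i → u i * A i j))) ⟩
    sumFin l (λ j → sumFin k (λ i → u i * A i j) * φ j)   ∎
    where open ≡-Reasoning

  sum-· : ∀ {k l} (A : Fin k → Fin l → Carrier) (φ : Fin l → Carrier) →
          sumFin k (A · φ) ≡ sumFin l (λ j → sumFin k (λ i → A i j) * φ j)
  sum-· {k} A φ = trans (sum-cong {k} (λ i → sym (*-identityˡ _)))
                (trans (sum-*-· (λ _ → 1#) A φ) (sum-cong (λ j → cong (_* φ j) (sum-cong (λ i → *-identityˡ (A i j))))))

  ·-mono-≤ : ∀ {k l} {A : Fin k → Fin l → Carrier} {φ φ′ : Fin l → Carrier} →
             (∀ i j → 0# ≤ A i j) → (∀ j → φ j ≤ φ′ j) → ∀ i → (A · φ) i ≤ (A · φ′) i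
  ·-mono-≤ A≥0 φ≤φ′ i = sum-mono-≤ (λ j → *-monoʳ-≤-nonNeg (A≥0 i j) (φ≤φ′ j))

  ·-neg : ∀ {k l} (A : Fin k → Fin l → Carrier) (φ : Fin l → Carrier) i → (A · (λ j → - φ j)) i ≡ - (A · φ) i
  ·-neg A φ i = trans (sum-cong (λ j → sym (-‿distribʳ-* (A i j) (φ j)))) (sum-neg (λ j → A i j * φ j))

  I : ∀ {k} → Fin k → Fin k → Carrier
  I x y = if does (x ≟ y) then 1# else 0#

  I·φ≡φ : ∀ {k} (φ : Fin k → Carrier) x → (I · φ) x ≡ φ x
  I·φ≡φ φ x = trans (sum-cong (λ y → trans (if-*ʳ (does (x ≟ y)) 1# (φ y))
                                           (cong (λ u → if does (x ≟ y) then u else 0#) (*-identityˡ (φ y)))))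
                (sum-indicator x φ)

  [M-I]·φ : ∀ {k} (M : Fin k → Fin k → Carrier) (φ : Fin k → Carrier) x → ((λ x y → M x y - I x y) · φ) x ≡ (M · φ) x - φ x
  [M-I]·φ M φ x = begin
    sumFin _ (λ y → (M x y - I x y) * φ y)
      ≡⟨ sum-cong (λ y → solve 3 (λ m i φ → (m :- i) :* φ := m :* φ :- i :* φ) refl (M x y) (I x y) (φ y)) ⟩
    sumFin _ (λ y → M x y * φ y - I x y * φ y)     ≡⟨ sum-- (λ y → M x y * φ y) (λ y → I x y * φ y) ⟩
    (M · φ) x - (I · φ) x                          ≡⟨ cong (λ u → (M · φ) x - u) (I·φ≡φ φ x) ⟩
    (M · φ) x - φ x                                ∎
    where open ≡-Reasoning

  dependent-rows-solution : ∀ {k} (A : Fin k → Fin k → Carrier) (u : Fin k → Carrier) → Nontrivial u →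
                            (∀ j → sumFin k (λ i → u i * A i j) ≡ 0#) → NontrivialSolution A
  dependent-rows-solution {suc k} A u (i₀ , uᵢ₀≢0) uA≡0 = extend (underdetermined-solution (ℕ.n<1+n k) (A ∘ punchIn i₀))
    where
      extend : NontrivialSolution (A ∘ punchIn i₀) → NontrivialSolution A
      extend (φ , φ≢0 , A′φ≡0) = φ , φ≢0 , solves
        where
          open ≡-Reasoning
          row-i₀ : (A · φ) i₀ ≡ 0#
          row-i₀ = x≢0∧x*y≡0⇒y≡0 uᵢ₀≢0 (begin
            u i₀ * (A · φ) i₀
              ≡⟨ sym (+-identityʳ _) ⟩
            u i₀ * (A · φ) i₀ + 0#
              ≡⟨ cong (u i₀ * (A · φ) i₀ +_) (sym (sum-zero (λ r → trans (cong (u (punchIn i₀ r) *_) (A′φ≡0 r)) (zeroʳ _)))) ⟩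
            u i₀ * (A · φ) i₀ + sumFin k (λ r → u (punchIn i₀ r) * (A · φ) (punchIn i₀ r))
              ≡⟨ sym (sum-punchIn i₀ (λ i → u i * (A · φ) i)) ⟩
            sumFin (suc k) (λ i → u i * (A · φ) i)
              ≡⟨ sum-*-· u A φ ⟩
            sumFin (suc k) (λ j → sumFin (suc k) (λ i → u i * A i j) * φ j)
              ≡⟨ sum-zero (λ j → trans (cong (_* φ j) (uA≡0 j)) (zeroˡ (φ j))) ⟩
            0# ∎)
          solves : ∀ i → (A · φ) i ≡ 0#
          solves i with i₀ ≟ i
          ... | yes refl  = row-i₀
          ... | no i₀≢i   = subst (λ x → (A · φ) x ≡ 0#) (punchIn-punchOut i₀≢i) (A′φ≡0 (punchOut i₀≢i))

  column-stochastic-fixedPoint :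
    ∀ {k} (S : Fin k → Set) → (∀ x → Dec (S x)) → (M : Fin k → Fin k → Carrier) →
    (∀ x y → 0# ≤ M x y) → (∀ x y → ¬ S x → M x y ≡ 0#) → (∀ x y → ¬ S y → M x y ≡ 0#) →
    (∀ y → S y → sumFin k (λ x → M x y) ≡ 1#) → Σ (Fin k) S →
    Σ (Fin k → Carrier) λ ψ → Nontrivial ψ × (∀ x → 0# ≤ ψ x) × (∀ x → (M · ψ) x ≡ ψ x)
  column-stochastic-fixedPoint {k} S S? M M≥0 M-row M-col colsum (s , s∈S) =
    nonnegative-fixedPoint (dependent-rows-solution (λ x y → M x y - I x y) u (s , us≢0) u[M-I]≡0)
    where
      open ≡-Reasoning
      -- the indicator of S is a left fixed vector of M, so M - I is singular
      u : Fin k → Carrier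
      u x = if does (S? x) then 1# else 0#

      us≢0 : u s ≢ 0#
      us≢0 with S? s
      ... | yes _   = 0≢1 ∘ sym
      ... | no s∉S  = ⊥-elim (s∉S s∈S)

      uM≡M : ∀ x y → u x * M x y ≡ M x y
      uM≡M x y with S? x
      ... | yes _   = *-identityˡ _
      ... | no x∉S  = trans (zeroˡ _) (sym (M-row x y x∉S))

      colsum≡u : ∀ y → sumFin k (λ x → M x y) ≡ u y
      colsum≡u y with S? y
      ... | yes y∈S = colsum y y∈S
      ... | no y∉S  = sum-zero (λ x → M-col x y y∉S)

      u[M-I]≡0 : ∀ y → sumFin k (λ x → u x * (M x y - I x y)) ≡ 0#
      u[M-I]≡0 y = begin
        sumFin k (λ x → u x * (M x y - I x y))
          ≡⟨ sum-cong (λ x → solve 3 (λ u m i → u :* (m :- i) := u :* m :- i :* u) refl (u x) (M x y) (I x y)) ⟩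
        sumFin k (λ x → u x * M x y - I x y * u x)
          ≡⟨ sum-- (λ x → u x * M x y) (λ x → I x y * u x) ⟩
        sumFin k (λ x → u x * M x y) - sumFin k (λ x → I x y * u x)
          ≡⟨ cong₂ _-_ (trans (sum-cong (λ x → uM≡M x y)) (colsum≡u y))
                       (trans (sum-cong (λ x → if-*ʳ (does (x ≟ y)) 1# (u x))) (sum-indicator′ y (λ x → 1# * u x))) ⟩
        u y - 1# * u y
          ≡⟨ cong (λ v → u y - v) (*-identityˡ (u y)) ⟩
        u y - u y
          ≡⟨ -‿inverseʳ (u y) ⟩
        0# ∎

      nonnegative-fixedPoint : NontrivialSolution (λ x y → M x y - I x y) →
                               Σ (Fin k → Carrier) λ ψ → Nontrivial ψ × (∀ x → 0# ≤ ψ x) × (∀ x → (M · ψ) x ≡ ψ x)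
      nonnegative-fixedPoint (φ , (j , φj≢0) , [M-I]φ≡0) =
        ψ , (j , ∣x∣≢0 φj≢0) , ψ≥0 , λ x → sym (sum-mono-tight ψ≤Mψ ΣMψ≤Σψ x)
        where
          Mφ≡φ : ∀ x → (M · φ) x ≡ φ x
          Mφ≡φ x = x∙y⁻¹≈ε⇒x≈y _ _ (trans (sym ([M-I]·φ M φ x)) ([M-I]φ≡0 x))

          ψ : Fin k → Carrier
          ψ x = ∣ φ x ∣

          ψ≥0 : ∀ x → 0# ≤ ψ x
          ψ≥0 x = 0≤∣x∣ (φ x)

          ψ≤Mψ : ∀ x → ψ x ≤ (M · ψ) x
          ψ≤Mψ x = ∣x∣≤t (subst (_≤ (M · ψ) x) (Mφ≡φ x) (·-mono-≤ M≥0 (λ y → x≤∣x∣ (φ y)) x))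
                         (subst (_≤ (M · ψ) x) (trans (·-neg M φ x) (cong -_ (Mφ≡φ x))) (·-mono-≤ M≥0 (λ y → -x≤∣x∣ (φ y)) x))

          uψ≤ψ : ∀ y → u y * ψ y ≤ ψ y
          uψ≤ψ y with S? y
          ... | yes _ = ≤-reflexive (*-identityˡ (ψ y))
          ... | no _  = subst (_≤ ψ y) (sym (zeroˡ (ψ y))) (ψ≥0 y)

          ΣMψ≤Σψ : sumFin k (M · ψ) ≤ sumFin k ψ
          ΣMψ≤Σψ = subst (_≤ sumFin k ψ) (sym (sum-· M ψ))
                     (sum-mono-≤ (λ y → subst (λ c → c * ψ y ≤ ψ y) (sym (colsum≡u y)) (uψ≤ψ y)))

module PaymentFunctionProperties (R : RealField) where
  open OrderedField R
  open Approximation R using (crossing)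
  open Networks R using (Network; PaymentFunctions; PiecewiseLinear; Lout)

  module _ {n m} (N : Network n m) where
    open Network N

    pay-mono : PaymentFunctions N → ∀ f {x y} → 0# ≤ x → x ≤ y → pay f x ≤ pay f y
    pay-mono (_ , mono , _) f {x} {y} 0≤x x≤y with x ≡? y
    ... | yes refl = ≤-refl
    ... | no x≢y   = subst (λ z → pay f x ≤ pay f z) (solve 2 (λ x y → x :+ (y :- x) := y) refl x y)
                       (mono f x (y - x) 0≤x (x<y⇒0<y-x (x≤y , x≢y)))

    record LeftPiece (f : Fin m) (t : Carrier) : Set where
      field
        start slope : Carrier
        slope≥0     : 0# ≤ slope
        start<t     : start < t
        affine      : ∀ z → start ≤ z → z < t → pay f z ≡ slope * (z - start) + pay f start

    left-piece : ∀ f → PiecewiseLinear N f → ∀ {t} → 0# < t → t ≤ Lout N (debtor f) → LeftPiece f t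
    left-piece f (k , x , sl , x₀≡0 , _ , xₖ≡L , sl≥0 , piece) {t} 0<t t≤L
      with crossing (suc k) x (subst (_< t) (sym x₀≡0) 0<t) (subst (t ≤_) (sym xₖ≡L) t≤L)
    ... | i , i<k , xᵢ<t , t≤xᵢ₊₁ = record
      { start   = x i
      ; slope   = sl (suc i)
      ; slope≥0 = sl≥0 i (ℕ.<⇒≤ i<k)
      ; start<t = xᵢ<t
      ; affine  = λ z xᵢ≤z z<t → piece i z (ℕ.<⇒≤ i<k) xᵢ≤z (λ _ → <-≤-trans z<t t≤xᵢ₊₁)
      }

module ImprovingTrade
  (R : RealField) {n m : ℕ} (N : Networks.Network R n m)
  (pf : Networks.PaymentFunctions R N) (pl : ∀ f → Networks.PiecewiseLinear R N f)
  (e : Fin m) (w : Fin n) (ρ : RealField.Carrier R) (a b : Fin n → RealField.Carrier R)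
  (a-minimal : Networks.MinimalClearingState R N a)
  (b-minimal : Networks.MinimalClearingState R (Networks.trade R N e w ρ) b)
  (v-gains : RealOps._<_ R (a (Networks.Network.creditor N e)) (b (Networks.Network.creditor N e)))
  (w-gains : RealOps._<_ R (a w) (b w))
  where

  open OrderedField R
  open Extrema R
  open Approximation R
  open FiniteSums R
  open LinearAlgebra R
  open PaymentFunctionProperties R
  open Networks R using (Network; trade; Lout; outPay; inPay)
  open Network N

  N′ : Network n m
  N′ = trade N e w ρ

  creditor′ : Fin m → Fin n
  creditor′ = Network.creditor N′

  ext′ : Fin n → Carrier
  ext′ = Network.ext N′

  L : Fin n → Carrier
  L = Lout N

  a≥0 : ∀ x → 0# ≤ a x
  a≥0 = proj₁ (proj₁ a-minimal)

  b≥0 : ∀ x → 0# ≤ b x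
  b≥0 = proj₁ (proj₁ b-minimal)

  a-clears : ∀ x → a x ≡ ext x + inPay N a x
  a-clears = proj₂ (proj₁ a-minimal)

  b-clears : ∀ x → b x ≡ ext′ x + inPay N′ b x
  b-clears = proj₂ (proj₁ b-minimal)

  outPay≡min : ∀ y z → 0# ≤ z → outPay N y z ≡ min z (L y)
  outPay≡min = proj₂ (proj₂ pf)

  S : Fin n → Set
  S x = a x < b x

  onS : Fin n → Carrier → Carrier
  onS x u = if does (a x <? b x) then u else 0#

  onS-∈ : ∀ {x} → S x → ∀ u → onS x u ≡ u
  onS-∈ {x} x∈S = if-yes (a x <? b x) x∈S

  onS-∉ : ∀ {x} → ¬ S x → ∀ u → onS x u ≡ 0#
  onS-∉ {x} x∉S = if-no (a x <? b x) x∉S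

  onS-creditor′ : ∀ f u → onS (creditor′ f) u ≡ onS (creditor f) u
  onS-creditor′ f u with f ≟ e
  ... | yes refl = trans (onS-∈ w-gains u) (sym (onS-∈ v-gains u))
  ... | no _     = refl

  sum-onS-fibres : ∀ (c : Fin m → Fin n) (g : Fin n → Fin m → Carrier) →
                   sumFin n (λ x → onS x (sumFin m (λ f → if does (c f ≟ x) then g x f else 0#)))
                   ≡ sumFin m (λ f → onS (c f) (g (c f) f))
  sum-onS-fibres c g = trans (sum-cong push-mask) (sum-fibres c (λ x f → onS x (g x f)))
    where
      push-mask : ∀ x → onS x (sumFin m (λ f → if does (c f ≟ x) then g x f else 0#))
                        ≡ sumFin m (λ f → if does (c f ≟ x) then onS x (g x f) else 0#)
      push-mask x = trans (if-sum (does (a x <? b x)) (λ f → if does (c f ≟ x) then g x f else 0#))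
                          (sum-cong (λ f → if-swap _ (does (c f ≟ x)) (g x f)))

  gain : Fin m → Carrier
  gain f = pay f (b (debtor f)) - pay f (a (debtor f))

  external-balance : sumFin n (λ x → onS x (ext′ x - ext x)) ≡ 0#
  external-balance = begin
    sumFin n (λ x → onS x (ext′ x - ext x))
      ≡⟨ sum-cong (λ x → trans (cong (onS x) (shift x)) (if-- (does (a x <? b x)) (V x) (W x))) ⟩
    sumFin n (λ x → onS x (V x) - onS x (W x))
      ≡⟨ sum-- (λ x → onS x (V x)) (λ x → onS x (W x)) ⟩
    sumFin n (λ x → onS x (V x)) - sumFin n (λ x → onS x (W x))
      ≡⟨ cong₂ _-_ (received v-gains) (received w-gains) ⟩
    ρ - ρ
      ≡⟨ -‿inverseʳ ρ ⟩
    0# ∎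
    where
      open ≡-Reasoning
      V W : Fin n → Carrier
      V x = if does (x ≟ creditor e) then ρ else 0#
      W x = if does (x ≟ w) then ρ else 0#
      shift : ∀ x → ext′ x - ext x ≡ V x - W x
      shift x = solve 3 (λ E W V → (E :- W) :+ V :- E := V :- W) refl (ext x) (W x) (V x)
      received : ∀ {c} → S c → sumFin n (λ x → onS x (if does (x ≟ c) then ρ else 0#)) ≡ ρ
      received {c} c∈S = trans (sum-cong (λ x → if-swap (does (a x <? b x)) (does (x ≟ c)) ρ))
                               (trans (sum-indicator′ c (λ x → onS x ρ)) (onS-∈ c∈S ρ))

  inflow-balance : sumFin n (λ x → onS x (b x - a x)) ≡ sumFin m (λ f → onS (creditor′ f) (gain f))
  inflow-balance = begin
    sumFin n (λ x → onS x (b x - a x))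
      ≡⟨ sum-cong split ⟩
    sumFin n (λ x → onS x (ext′ x - ext x) + (onS x (inPay N′ b x) - onS x (inPay N a x)))
      ≡⟨ trans (sum-+ (λ x → onS x (ext′ x - ext x)) _) (cong₂ _+_ external-balance (sum-- (λ x → onS x (inPay N′ b x)) _)) ⟩
    0# + (sumFin n (λ x → onS x (inPay N′ b x)) - sumFin n (λ x → onS x (inPay N a x)))
      ≡⟨ trans (+-identityˡ _) (cong₂ _-_ (sum-onS-fibres creditor′ (λ _ f → pay f (b (debtor f))))
                                          (trans (sum-onS-fibres creditor (λ _ f → pay f (a (debtor f))))
                                                 (sum-cong (λ f → sym (onS-creditor′ f _))))) ⟩
    sumFin m (λ f → onS (creditor′ f) (pay f (b (debtor f)))) - sumFin m (λ f → onS (creditor′ f) (pay f (a (debtor f))))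
      ≡⟨ sym (trans (sum-cong (λ f → if-- (does (a (creditor′ f) <? b (creditor′ f))) _ _))
                 (sum-- (λ f → onS (creditor′ f) (pay f (b (debtor f)))) (λ f → onS (creditor′ f) (pay f (a (debtor f)))))) ⟩
    sumFin m (λ f → onS (creditor′ f) (gain f)) ∎
    where
      open ≡-Reasoning
      split : ∀ x → onS x (b x - a x) ≡ onS x (ext′ x - ext x) + (onS x (inPay N′ b x) - onS x (inPay N a x))
      split x = begin
        onS x (b x - a x)
          ≡⟨ cong (onS x) (trans (cong₂ _-_ (b-clears x) (a-clears x))
                                 (solve 4 (λ E′ P′ E P → (E′ :+ P′) :- (E :+ P) := (E′ :- E) :+ (P′ :- P)) refl
                                          (ext′ x) (inPay N′ b x) (ext x) (inPay N a x))) ⟩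
        onS x ((ext′ x - ext x) + (inPay N′ b x - inPay N a x))
          ≡⟨ trans (if-+ (does (a x <? b x)) _ _) (cong (onS x (ext′ x - ext x) +_) (if-- (does (a x <? b x)) _ _)) ⟩
        onS x (ext′ x - ext x) + (onS x (inPay N′ b x) - onS x (inPay N a x)) ∎

  outflow-balance : sumFin m (λ f → onS (debtor f) (gain f)) ≡ sumFin n (λ y → onS y (min (b y) (L y) - min (a y) (L y)))
  outflow-balance = sym (begin
    sumFin n (λ y → onS y (min (b y) (L y) - min (a y) (L y)))
      ≡⟨ sum-cong (λ y → cong (onS y) (sym (cong₂ _-_ (outPay≡min y (b y) (b≥0 y)) (outPay≡min y (a y) (a≥0 y))))) ⟩
    sumFin n (λ y → onS y (outPay N y (b y) - outPay N y (a y)))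
      ≡⟨ sum-cong (λ y → cong (onS y) (trans (sym (sum-- (λ f → if does (debtor f ≟ y) then pay f (b y) else 0#) _))
                                             (sum-cong (λ f → sym (if-- (does (debtor f ≟ y)) _ _))))) ⟩
    sumFin n (λ y → onS y (sumFin m (λ f → if does (debtor f ≟ y) then pay f (b y) - pay f (a y) else 0#)))
      ≡⟨ sum-onS-fibres debtor (λ y f → pay f (b y) - pay f (a y)) ⟩
    sumFin m (λ f → onS (debtor f) (gain f)) ∎)
    where open ≡-Reasoning

  gain-creditor≤debtor : ∀ f → onS (creditor′ f) (gain f) ≤ onS (debtor f) (gain f)
  gain-creditor≤debtor f with a (debtor f) <? b (debtor f)
  ... | yes d∈S = if-≤ (does (a (creditor′ f) <? b (creditor′ f))) (x≤y⇒0≤y-x (pay-mono N pf f (a≥0 _) (<⇒≤ d∈S)))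
  ... | no d∉S  = if-≤0 (does (a (creditor′ f) <? b (creditor′ f))) (x≤y⇒x-y≤0 (pay-mono N pf f (b≥0 _) (≮⇒≥ d∉S)))

  capped-gain≤gain : ∀ y → onS y (min (b y) (L y) - min (a y) (L y)) ≤ onS y (b y - a y)
  capped-gain≤gain y with a y <? b y
  ... | yes y∈S = min-sub-min≤sub (L y) (<⇒≤ y∈S)
  ... | no _    = ≤-refl

  edge-tight : ∀ f → onS (creditor′ f) (gain f) ≡ onS (debtor f) (gain f)
  edge-tight = sum-mono-tight gain-creditor≤debtor (begin
    sumFin m (λ f → onS (debtor f) (gain f))                        ≡⟨ outflow-balance ⟩
    sumFin n (λ y → onS y (min (b y) (L y) - min (a y) (L y)))     ≤⟨ sum-mono-≤ capped-gain≤gain ⟩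
    sumFin n (λ y → onS y (b y - a y))                              ≡⟨ inflow-balance ⟩
    sumFin m (λ f → onS (creditor′ f) (gain f))                     ∎)
    where open ≤-Reasoning

  node-tight : ∀ y → onS y (min (b y) (L y) - min (a y) (L y)) ≡ onS y (b y - a y)
  node-tight = sum-mono-tight capped-gain≤gain (begin
    sumFin n (λ y → onS y (b y - a y))                              ≡⟨ inflow-balance ⟩
    sumFin m (λ f → onS (creditor′ f) (gain f))                     ≤⟨ sum-mono-≤ gain-creditor≤debtor ⟩
    sumFin m (λ f → onS (debtor f) (gain f))                        ≡⟨ outflow-balance ⟩
    sumFin n (λ y → onS y (min (b y) (L y) - min (a y) (L y)))     ∎)
    where open ≤-Reasoning

  b≤L : ∀ y → S y → b y ≤ L y
  b≤L y y∈S = ≮⇒≥ λ L<b → <-irrefl (trans (sym (onS-∈ y∈S _)) (trans (node-tight y) (onS-∈ y∈S _)))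
                                    (min-sub-min<sub (L y) y∈S L<b)

  gain-flat : ∀ f → S (debtor f) → ¬ S (creditor′ f) → pay f (b (debtor f)) ≡ pay f (a (debtor f))
  gain-flat f d∈S c∉S = x∙y⁻¹≈ε⇒x≈y _ _ (trans (sym (onS-∈ d∈S (gain f))) (trans (sym (edge-tight f)) (onS-∉ c∉S (gain f))))

  piece : ∀ f → S (debtor f) → LeftPiece N f (b (debtor f))
  piece f d∈S = left-piece N f (pl f) (≤-<-trans (a≥0 _) d∈S) (b≤L _ d∈S)

  -- Outside S the slope is 0 and the start is a junk value.
  slope start : Fin m → Carrier
  slope f with a (debtor f) <? b (debtor f)
  ... | yes d∈S = LeftPiece.slope (piece f d∈S)
  ... | no _    = 0#
  start f with a (debtor f) <? b (debtor f)
  ... | yes d∈S = LeftPiece.start (piece f d∈S)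
  ... | no _    = 0#

  slope≥0 : ∀ f → 0# ≤ slope f
  slope≥0 f with a (debtor f) <? b (debtor f)
  ... | yes d∈S = LeftPiece.slope≥0 (piece f d∈S)
  ... | no _    = ≤-refl

  slope-∉ : ∀ f → ¬ S (debtor f) → slope f ≡ 0#
  slope-∉ f d∉S with a (debtor f) <? b (debtor f)
  ... | yes d∈S = ⊥-elim (d∉S d∈S)
  ... | no _    = refl

  start<b : ∀ f → S (debtor f) → start f < b (debtor f)
  start<b f d∈S with a (debtor f) <? b (debtor f)
  ... | yes d∈S′ = LeftPiece.start<t (piece f d∈S′)
  ... | no d∉S   = ⊥-elim (d∉S d∈S)

  affine : Fin m → Carrier → Carrier
  affine f z = slope f * (z - start f) + pay f (start f)

  pay≡affine : ∀ f → S (debtor f) → ∀ z → start f ≤ z → z < b (debtor f) → pay f z ≡ affine f z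
  pay≡affine f d∈S with a (debtor f) <? b (debtor f)
  ... | yes d∈S′ = LeftPiece.affine (piece f d∈S′)
  ... | no d∉S   = ⊥-elim (d∉S d∈S)

  affine-shift : ∀ f z s → affine f (z - s) ≡ affine f z - slope f * s
  affine-shift f z s = solve 5 (λ σ z s x₀ p₀ → σ :* ((z :- s) :- x₀) :+ p₀ := (σ :* (z :- x₀) :+ p₀) :- σ :* s) refl
                               (slope f) z s (start f) (pay f (start f))

  -- Claims not owed by y contribute a y, which lies below the threshold anyway.
  candidate : Fin n → Fin m → Carrier
  candidate y f = if does (debtor f ≟ y) then start f else a y

  threshold : Fin n → Carrier
  threshold y = foldr _⊔_ (a y) (candidate y)

  a≤threshold : ∀ y → a y ≤ threshold y
  a≤threshold y = x≤foldr-⊔ (a y) (candidate y)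

  start≤threshold : ∀ f → start f ≤ threshold (debtor f)
  start≤threshold f = subst (_≤ threshold (debtor f)) (if-yes (debtor f ≟ debtor f) refl (start f))
                        (c≤foldr-⊔ (a (debtor f)) (candidate (debtor f)) f)

  threshold<b : ∀ y → S y → threshold y < b y
  threshold<b y y∈S = foldr-⊔-< (a y) (candidate y) y∈S below
    where
      below : ∀ f → candidate y f < b y
      below f with debtor f ≟ y
      ... | yes refl = start<b f y∈S
      ... | no _     = y∈S

  module AtNode (y : Fin n) (y∈S : S y) where

    X : Carrier
    X = threshold y

    X<b : X < b y
    X<b = threshold<b y y∈S

    0≤X : 0# ≤ X
    0≤X = ≤-trans (a≥0 y) (a≤threshold y)

    owed : Fin m → Carrier → Carrier
    owed f u = if does (debtor f ≟ y) then u else 0#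

    pays-in-full : ∀ z → X ≤ z → z < b y → sumFin m (λ f → owed f (pay f z)) ≡ z
    pays-in-full z X≤z z<b = trans (outPay≡min y z (≤-trans 0≤X X≤z)) (min≡ˡ (≤-trans (<⇒≤ z<b) (b≤L y y∈S)))

    owed-affine : ∀ z → X ≤ z → z < b y → ∀ f → owed f (pay f z) ≡ owed f (affine f z)
    owed-affine z X≤z z<b f with debtor f ≟ y
    ... | yes refl = pay≡affine f y∈S z (≤-trans (start≤threshold f) X≤z) z<b
    ... | no _     = refl

    total-slope intercept : Carrier
    total-slope = sumFin m (λ f → owed f (slope f))
    intercept   = sumFin m (λ f → owed f (pay f (start f) - slope f * start f))

    sum-affine : ∀ z → sumFin m (λ f → owed f (affine f z)) ≡ total-slope * z + intercept
    sum-affine z = begin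
      sumFin m (λ f → owed f (affine f z))
        ≡⟨ sum-cong linear ⟩
      sumFin m (λ f → owed f (slope f) * z + owed f (pay f (start f) - slope f * start f))
        ≡⟨ sum-+ (λ f → owed f (slope f) * z) _ ⟩
      sumFin m (λ f → owed f (slope f) * z) + intercept
        ≡⟨ cong (_+ intercept) (sum-*ʳ z (λ f → owed f (slope f))) ⟩
      total-slope * z + intercept ∎
      where
        open ≡-Reasoning
        linear : ∀ f → owed f (affine f z) ≡ owed f (slope f) * z + owed f (pay f (start f) - slope f * start f)
        linear f = begin
          owed f (affine f z)
            ≡⟨ cong (owed f) (solve 4 (λ σ z x₀ p₀ → σ :* (z :- x₀) :+ p₀ := σ :* z :+ (p₀ :- σ :* x₀)) refl
                                      (slope f) z (start f) (pay f (start f))) ⟩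
          owed f (slope f * z + (pay f (start f) - slope f * start f))
            ≡⟨ if-+ (does (debtor f ≟ y)) _ _ ⟩
          owed f (slope f * z) + owed f (pay f (start f) - slope f * start f)
            ≡⟨ cong (_+ owed f (pay f (start f) - slope f * start f)) (sym (if-*ʳ (does (debtor f ≟ y)) (slope f) z)) ⟩
          owed f (slope f) * z + owed f (pay f (start f) - slope f * start f) ∎

    -- On [X, b y) the claims owed by y pay exactly their argument in total, and all are affine there.
    unit-slope : (total-slope ≡ 1#) × (intercept ≡ 0#)
    unit-slope = affine-fixing-two-points (proj₂ X<mid) (fixes X ≤-refl X<b) (fixes mid (<⇒≤ X<mid) mid<b)
      where
        fixes : ∀ z → X ≤ z → z < b y → total-slope * z + intercept ≡ z
        fixes z X≤z z<b = trans (sym (sum-affine z)) (trans (sym (sum-cong (owed-affine z X≤z z<b))) (pays-in-full z X≤z z<b))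
        mid = proj₁ (between X<b)
        X<mid = proj₁ (proj₂ (between X<b))
        mid<b = proj₂ (proj₂ (between X<b))

    affine≤pay : ∀ f → debtor f ≡ y → affine f (b y) ≤ pay f (b y)
    affine≤pay f refl = ≤-of-≤-minus-small (x<y⇒0<y-x X<b) (slope≥0 f) below
      where
        open ≤-Reasoning
        below : ∀ s → 0# < s → s ≤ b y - X → affine f (b y) - slope f * s ≤ pay f (b y)
        below s 0<s s≤b-X = begin
          affine f (b y) - slope f * s  ≡⟨ sym (affine-shift f (b y) s) ⟩
          affine f (b y - s)            ≡⟨ sym (pay≡affine f y∈S (b y - s) (≤-trans (start≤threshold f) X≤b-s) (x-y<x (b y) 0<s)) ⟩
          pay f (b y - s)               ≤⟨ pay-mono N pf f (≤-trans 0≤X X≤b-s) (<⇒≤ (x-y<x (b y) 0<s)) ⟩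
          pay f (b y)                   ∎
          where X≤b-s = s≤y-x⇒x≤y-s s≤b-X

    pay≡affine-at-b : ∀ f → debtor f ≡ y → pay f (b y) ≡ affine f (b y)
    pay≡affine-at-b f d≡y = sym (begin
      affine f (b y)          ≡⟨ sym (if-yes (debtor f ≟ y) d≡y _) ⟩
      owed f (affine f (b y)) ≡⟨ sum-mono-tight owed-affine≤pay Σpay≤Σaffine f ⟩
      owed f (pay f (b y))    ≡⟨ if-yes (debtor f ≟ y) d≡y _ ⟩
      pay f (b y)             ∎)
      where
        open ≡-Reasoning
        owed-affine≤pay : ∀ f → owed f (affine f (b y)) ≤ owed f (pay f (b y))
        owed-affine≤pay f with debtor f ≟ y
        ... | yes d≡y = affine≤pay f d≡y
        ... | no _    = ≤-refl
        Σpay≤Σaffine : sumFin m (λ f → owed f (pay f (b y))) ≤ sumFin m (λ f → owed f (affine f (b y)))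
        Σpay≤Σaffine = ≤-reflexive (begin
          sumFin m (λ f → owed f (pay f (b y)))     ≡⟨ trans (outPay≡min y (b y) (b≥0 y)) (min≡ˡ (b≤L y y∈S)) ⟩
          b y                                       ≡⟨ sym (*-identityˡ (b y)) ⟩
          1# * b y                                  ≡⟨ sym (+-identityʳ _) ⟩
          1# * b y + 0#                             ≡⟨ sym (cong₂ (λ σ β → σ * b y + β) (proj₁ unit-slope) (proj₂ unit-slope)) ⟩
          total-slope * b y + intercept             ≡⟨ sym (sum-affine (b y)) ⟩
          sumFin m (λ f → owed f (affine f (b y))) ∎)

    pay-shift : ∀ f → debtor f ≡ y → ∀ s → 0# ≤ s → s ≤ b y - X → pay f (b y - s) ≡ pay f (b y) - slope f * s
    pay-shift f refl s 0≤s s≤b-X with s ≡? 0#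
    ... | yes refl = trans (cong (pay f) (x-0≡x (b y))) (sym (x-y*0≡x (pay f (b y)) (slope f)))
    ... | no s≢0   = begin
      pay f (b y - s)              ≡⟨ pay≡affine f y∈S (b y - s) (≤-trans (start≤threshold f) (s≤y-x⇒x≤y-s s≤b-X))
                                                       (x-y<x (b y) (0≤s , s≢0 ∘ sym)) ⟩
      affine f (b y - s)           ≡⟨ affine-shift f (b y) s ⟩
      affine f (b y) - slope f * s ≡⟨ cong (_- slope f * s) (sym (pay≡affine-at-b f refl)) ⟩
      pay f (b y) - slope f * s    ∎
      where open ≡-Reasoning

    slope-flat : ∀ f → debtor f ≡ y → ¬ S (creditor′ f) → slope f ≡ 0#
    slope-flat f refl c∉S = x≢0∧x*y≡0⇒y≡0 (proj₂ 0<b-X ∘ sym) (trans (*-comm _ (slope f)) (x-y≡x⇒y≡0 shifted))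
      where
        0<b-X = x<y⇒0<y-x X<b
        pay-X≡pay-b : pay f X ≡ pay f (b y)
        pay-X≡pay-b = ≤-antisym (pay-mono N pf f 0≤X (<⇒≤ X<b))
                                (subst (_≤ pay f X) (sym (gain-flat f y∈S c∉S)) (pay-mono N pf f (a≥0 y) (a≤threshold y)))
        shifted : pay f (b y) - slope f * (b y - X) ≡ pay f (b y)
        shifted = trans (sym (pay-shift f refl (b y - X) (<⇒≤ 0<b-X) ≤-refl))
                        (trans (cong (pay f) (solve 2 (λ b X → b :- (b :- X) := X) refl (b y) X)) pay-X≡pay-b)

  slope-vanishes : ∀ f → ¬ (S (debtor f) × S (creditor′ f)) → slope f ≡ 0#
  slope-vanishes f not-both = by-cases (a (debtor f) <? b (debtor f)) (a (creditor′ f) <? b (creditor′ f))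
    where
      by-cases : Dec (S (debtor f)) → Dec (S (creditor′ f)) → slope f ≡ 0#
      by-cases (yes d∈S) (yes c∈S) = ⊥-elim (not-both (d∈S , c∈S))
      by-cases (yes d∈S) (no c∉S)  = AtNode.slope-flat (debtor f) d∈S f refl c∉S
      by-cases (no d∉S)  _         = slope-∉ f d∉S

  M : Fin n → Fin n → Carrier
  M x y = sumFin m (λ f → if does (creditor′ f ≟ x) then (if does (debtor f ≟ y) then slope f else 0#) else 0#)

  M≥0 : ∀ x y → 0# ≤ M x y
  M≥0 x y = sum-nonneg (λ f → if-nonneg (does (creditor′ f ≟ x)) (if-nonneg (does (debtor f ≟ y)) (slope≥0 f)))

  M-entry-zero : ∀ x y → (∀ f → creditor′ f ≡ x → debtor f ≡ y → slope f ≡ 0#) → M x y ≡ 0#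
  M-entry-zero x y vanishes = sum-zero entry
    where
      entry : ∀ f → (if does (creditor′ f ≟ x) then (if does (debtor f ≟ y) then slope f else 0#) else 0#) ≡ 0#
      entry f with creditor′ f ≟ x | debtor f ≟ y
      ... | yes c≡x | yes d≡y = vanishes f c≡x d≡y
      ... | yes _   | no _    = refl
      ... | no _    | _       = refl

  M-row : ∀ x y → ¬ S x → M x y ≡ 0#
  M-row x y x∉S = M-entry-zero x y λ { f refl _ → slope-vanishes f (x∉S ∘ proj₂) }

  M-column : ∀ x y → ¬ S y → M x y ≡ 0#
  M-column x y y∉S = M-entry-zero x y λ { f _ refl → slope-vanishes f (y∉S ∘ proj₁) }

  M-column-sum : ∀ y → S y → sumFin n (λ x → M x y) ≡ 1#
  M-column-sum y y∈S = trans (sum-fibres creditor′ (λ _ f → if does (debtor f ≟ y) then slope f else 0#))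
                             (proj₁ (AtNode.unit-slope y y∈S))

  M·ψ≡inflow : ∀ ψ x → (M · ψ) x ≡ sumFin m (λ f → if does (creditor′ f ≟ x) then slope f * ψ (debtor f) else 0#)
  M·ψ≡inflow ψ x = begin
    sumFin n (λ y → M x y * ψ y)
      ≡⟨ sum-cong (λ y → sym (sum-*ʳ (ψ y) (λ f → entry f y))) ⟩
    sumFin n (λ y → sumFin m (λ f → entry f y * ψ y))
      ≡⟨ sum-comm (λ y f → entry f y * ψ y) ⟩
    sumFin m (λ f → sumFin n (λ y → entry f y * ψ y))
      ≡⟨ sum-cong per-claim ⟩
    sumFin m (λ f → if does (creditor′ f ≟ x) then slope f * ψ (debtor f) else 0#) ∎
    where
      open ≡-Reasoning
      entry : Fin m → Fin n → Carrier
      entry f y = if does (creditor′ f ≟ x) then (if does (debtor f ≟ y) then slope f else 0#) else 0#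
      per-claim : ∀ f → sumFin n (λ y → entry f y * ψ y) ≡ (if does (creditor′ f ≟ x) then slope f * ψ (debtor f) else 0#)
      per-claim f with does (creditor′ f ≟ x)
      ... | true  = trans (sum-cong (λ y → if-*ʳ (does (debtor f ≟ y)) (slope f) (ψ y))) (sum-indicator (debtor f) (λ y → slope f * ψ y))
      ... | false = sum-zero (λ y → zeroˡ (ψ y))

  -- Outside S, where ψ will vanish, any positive gap will do.
  gap : Fin n → Carrier
  gap y = if does (a y <? b y) then b y - threshold y else 1#

  0<gap : ∀ y → 0# < gap y
  0<gap y with a y <? b y
  ... | yes y∈S = x<y⇒0<y-x (threshold<b y y∈S)
  ... | no _    = 0<1

  module Perturbation (ψ : Fin n → Carrier) (j : Fin n) (ψj≢0 : ψ j ≢ 0#) (ψ≥0 : ∀ x → 0# ≤ ψ x)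
                      (Mψ≡ψ : ∀ x → (M · ψ) x ≡ ψ x) (t : Carrier) (0<t : 0# < t) (tψ≤gap : ∀ y → t * ψ y ≤ gap y) where

    ψ-∉ : ∀ x → ¬ S x → ψ x ≡ 0#
    ψ-∉ x x∉S = trans (sym (Mψ≡ψ x)) (sum-zero (λ y → trans (cong (_* ψ y) (M-row x y x∉S)) (zeroˡ (ψ y))))

    tψ≤b-X : ∀ y → S y → t * ψ y ≤ b y - threshold y
    tψ≤b-X y y∈S = subst (t * ψ y ≤_) (if-yes (a y <? b y) y∈S _) (tψ≤gap y)

    0≤tψ : ∀ y → 0# ≤ t * ψ y
    0≤tψ y = *-nonneg (<⇒≤ 0<t) (ψ≥0 y)

    z : Fin n → Carrier
    z y = b y - t * ψ y

    z-∉ : ∀ y → ¬ S y → z y ≡ b y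
    z-∉ y y∉S = trans (cong (λ u → b y - t * u) (ψ-∉ y y∉S)) (x-y*0≡x (b y) t)

    z≥0 : ∀ y → 0# ≤ z y
    z≥0 y with a y <? b y
    ... | yes y∈S = ≤-trans (a≥0 y) (≤-trans (a≤threshold y) (s≤y-x⇒x≤y-s (tψ≤b-X y y∈S)))
    ... | no y∉S  = subst (0# ≤_) (sym (z-∉ y y∉S)) (b≥0 y)

    pay-at-z : ∀ f → pay f (z (debtor f)) ≡ pay f (b (debtor f)) - slope f * (t * ψ (debtor f))
    pay-at-z f = by-cases (a (debtor f) <? b (debtor f))
      where
        by-cases : Dec (S (debtor f)) → pay f (z (debtor f)) ≡ pay f (b (debtor f)) - slope f * (t * ψ (debtor f))
        by-cases (yes d∈S) = AtNode.pay-shift (debtor f) d∈S f refl (t * ψ (debtor f)) (0≤tψ (debtor f)) (tψ≤b-X (debtor f) d∈S)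
        by-cases (no d∉S)  = trans (cong (pay f) (z-∉ (debtor f) d∉S))
                               (sym (trans (cong (λ σ → pay f (b (debtor f)) - σ * (t * ψ (debtor f))) (slope-∉ f d∉S)) (x-0*y≡x _ _)))

    z-clears : ∀ x → z x ≡ ext′ x + inPay N′ z x
    z-clears x = sym (begin
      ext′ x + inPay N′ z x
        ≡⟨ cong (ext′ x +_) (sum-cong (λ f → trans (cong (λ p → if does (creditor′ f ≟ x) then p else 0#) (pay-at-z f)) (lower f))) ⟩
      ext′ x + sumFin m (λ f → received f - t * drained f)
        ≡⟨ cong (ext′ x +_) (sum-- received (λ f → t * drained f)) ⟩
      ext′ x + (inPay N′ b x - sumFin m (λ f → t * drained f))
        ≡⟨ cong (λ u → ext′ x + (inPay N′ b x - u)) (trans (sum-*ˡ t drained) (cong (t *_) (trans (sym (M·ψ≡inflow ψ x)) (Mψ≡ψ x)))) ⟩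
      ext′ x + (inPay N′ b x - t * ψ x)
        ≡⟨ sym (+-assoc _ _ _) ⟩
      (ext′ x + inPay N′ b x) - t * ψ x
        ≡⟨ cong (_- t * ψ x) (sym (b-clears x)) ⟩
      z x ∎)
      where
        open ≡-Reasoning
        received drained : Fin m → Carrier
        received f = if does (creditor′ f ≟ x) then pay f (b (debtor f)) else 0#
        drained  f = if does (creditor′ f ≟ x) then slope f * ψ (debtor f) else 0#
        lower : ∀ f → (if does (creditor′ f ≟ x) then pay f (b (debtor f)) - slope f * (t * ψ (debtor f)) else 0#)
                      ≡ received f - t * drained f
        lower f with does (creditor′ f ≟ x)
        ... | true  = solve 4 (λ p σ t ψ → p :- σ :* (t :* ψ) := p :- t :* (σ :* ψ)) refl (pay f (b (debtor f))) (slope f) t (ψ (debtor f))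
        ... | false = sym (x-y*0≡x 0# t)

    smaller-clearing-state : ⊥
    smaller-clearing-state = <⇒≱ zj<bj (proj₂ b-minimal z (z≥0 , z-clears) j)
      where
        zj<bj : z j < b j
        zj<bj = x-y<x (b j) (*-pos 0<t (ψ≥0 j , ψj≢0 ∘ sym))

  absurd : ⊥
  absurd = from-fixedPoint (column-stochastic-fixedPoint S (λ x → a x <? b x) M M≥0 M-row M-column M-column-sum (creditor e , v-gains))
    where
      from-fixedPoint : Σ (Fin n → Carrier) (λ ψ → Nontrivial ψ × (∀ x → 0# ≤ ψ x) × (∀ x → (M · ψ) x ≡ ψ x)) → ⊥
      from-fixedPoint (ψ , (j , ψj≢0) , ψ≥0 , Mψ≡ψ) = from-scale (uniform-small-multiple n gap ψ 0<gap ψ≥0)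
        where
          from-scale : Σ Carrier (λ t → (0# < t) × (∀ y → t * ψ y ≤ gap y)) → ⊥
          from-scale (t , 0<t , tψ≤gap) = Perturbation.smaller-clearing-state ψ j ψj≢0 ψ≥0 Mψ≡ψ t 0<t tψ≤gap

theorem3 : (R : RealField) → let open Networks R in
    {n m : ℕ} (N : Network n m) →
    WellFormed N →
    PaymentFunctions N →
    (∀ e → PiecewiseLinear N e) →
    (∀ e → StrictlyMonotone N e) →
    (e : Fin m) (w : Fin n) (ρ : Carrier) →
    AdmissibleReturn N e w ρ →
    WellFormed (trade N e w ρ) →
    (â âρ : Fin n → Carrier) →
    MinimalClearingState N â →
    MinimalClearingState (trade N e w ρ) âρ →
    ¬ ((â (Network.creditor N e) < âρ (Network.creditor N e)) × (â w < âρ w))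
theorem3 R N _ pf pl _ e w ρ _ _ â âρ â-minimal âρ-minimal (v-gains , w-gains) =
  ImprovingTrade.absurd R N pf pl e w ρ â âρ â-minimal âρ-minimal v-gains w-gains
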